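{- Let ${\bf x}=(x_1,\dots,x_n)$, $\overline{{\bf x}}=(\overline{x}_1,\dots,\overline{x}_n)$ with $\overline{x}_k=x_k^{ -1}$, and for $i=1,\dots,n$ let ${\bf x}^{(i)}=(x_i,x_{i+1},\dots,x_n)$ and $\overline{{\bf x}}^{(i)}=(\overline{x}_i,\dots,\overline{x}_n)$. Then for any partition $\lambda=(\lambda_1,\dots,\lambda_n)$ of length at most $n$ and any ${\bf a}=(a_1,a_2,\ldots)$, with $n\times n$ determinants whose $(i,j)$ entry is displayed, $$gl_\lambda({\bf x}|{\bf a})=\left|\,h^{gl}_{\lambda_j-j+i}({\bf x}^{(i)}|{\bf a})\,\right|,\qquad sp_\lambda({\bf x},\overline{{\bf x}}|{\bf a})=\left|\,h^{sp}_{\lambda_j-j+i}({\bf x}^{(i)},\overline{{\bf x}}^{(i)}|{\bf a})\,\right|,$$ $$so_\lambda({\bf x},\overline{{\bf x}},1|{\bf a})=\left|\,h^{oo}_{\lambda_j-j+i}({\bf x}^{(i)},\overline{{\bf x}}^{(i)},1|{\bf a})\,\right|,\qquad o_\lambda({\bf x},\overline{{\bf x}}|{\bf a})=\left|\,h^{eo}_{\lambda_j-j+i}({\bf x}^{(i)},\overline{{\bf x}}^{(i)}|{\bf a})\,\right|.$$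
   Context: For an indeterminate $y$ and integer $m\ge0$, $(y|{\bf a})^m=(y+a_1)\cdots(y+a_m)$ for $m>0$ and $(y|{\bf a})^0=1$. The factorial characters are ($n\times n$ determinants, $(i,j)$ entry shown): $gl_\lambda({\bf x}|{\bf a})=\left|(x_i|{\bf a})^{\lambda_j+n-j}\right|/\left|(x_i|{\bf a})^{n-j}\right|$; $sp_\lambda({\bf x},\overline{{\bf x}}|{\bf a})=\left|x_i(x_i|{\bf a})^{\lambda_j+n-j}-\overline{x}_i(\overline{x}_i|{\bf a})^{\lambda_j+n-j}\right|/\left|x_i(x_i|{\bf a})^{n-j}-\overline{x}_i(\overline{x}_i|{\bf a})^{n-j}\right|$; $so_\lambda({\bf x},\overline{{\bf x}},1|{\bf a})=\left|x_i^{1/2}(x_i|{\bf a})^{\lambda_j+n-j}-\overline{x}_i^{1/2}(\overline{x}_i|{\bf a})^{\lambda_j+n-j}\right|/\left|x_i^{1/2}(x_i|{\bf a})^{n-j}-\overline{x}_i^{1/2}(\overline{x}_i|{\bf a})^{n-j}\right|$; $o_\lambda({\bf x},\overline{{\bf x}}|{\bf a})=\eta\left|(x_i|{\bf a})^{\lambda_j+n-j}+(\overline{x}_i|{\bf a})^{\lambda_j+n-j}\right|/\big(\tfrac12\left|(x_i|{\bf a})^{n-j}+(\overline{x}_i|{\bf a})^{n-j}\right|\big)$ with $\eta=\tfrac12$ if $\lambda_n=0$ and $\eta=1$ if $\lambda_n>0$. $[t^m]F(t)$ is the coefficient of $t^m$. For a list of $p\ge1$ variables ${\bf y}=(y_1,\dots,y_p)$,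 $\overline{y}_k=y_k^{ -1}$, and any integer $m$: $h^{gl}_m({\bf y}|{\bf a})=[t^m]\prod_{k=1}^p\frac{1}{1-ty_k}\prod_{l=1}^{p+m-1}(1+ta_l)$; $h^{sp}_m({\bf y},\overline{{\bf y}}|{\bf a})=[t^m]\prod_{k=1}^p\frac{1}{(1-ty_k)(1-t\overline{y}_k)}\prod_{l=1}^{p+m-1}(1+ta_l)$; $h^{oo}_m({\bf y},\overline{{\bf y}},1|{\bf a})=[t^m](1+t)\prod_{k=1}^p\frac{1}{(1-ty_k)(1-t\overline{y}_k)}\prod_{l=1}^{p+m-1}(1+ta_l)$; $h^{eo}_m({\bf y},\overline{{\bf y}}|{\bf a})=[t^m]\big(\frac{1}{1-ty_1}+\frac{1}{1-t\overline{y}_1}-\delta_{m0}\big)\prod_{l=1}^{m}(1+ta_l)$ if $p=1$, and $[t^m](1-t^2)\prod_{k=1}^p\frac{1}{(1-ty_k)(1-t\overline{y}_k)}\prod_{l=1}^{p+m-1}(1+ta_l)$ if $p>1$ ($\delta_{m0}=1$ if $m=0$, else $0$). All of these equal $1$ for $m=0$ and $0$ for $m<0$. -}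

module Defs where

open import Level using (Level)
open import Algebra.Bundles using (CommutativeRing)
open import Data.Nat as ℕ using (ℕ; zero; suc; _∸_)
open import Data.Integer as ℤ using (ℤ; +_; -[1+_])
open import Data.Fin as Fin using (Fin; toℕ; punchIn; fromℕ)
open import Data.List as List using (List; []; _∷_; length; drop)
open import Data.Product using (_×_; _,_; proj₁; proj₂)

module Factorial {c ℓ : Level} (R : CommutativeRing c ℓ) where
  open CommutativeRing R

  sumUpTo : ℕ → (ℕ → Carrier) → Carrier
  sumUpTo zero    f = 0#
  sumUpTo (suc m) f = sumUpTo m f + f m

  prodUpTo : ℕ → (ℕ → Carrier) → Carrier
  prodUpTo zero    f = 1#
  prodUpTo (suc m) f = prodUpTo m f * f m

  sumFin : (n : ℕ) → (Fin n → Carrier) → Carrier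
  sumFin zero    f = 0#
  sumFin (suc n) f = f Fin.zero + sumFin n (λ k → f (Fin.suc k))

  pow : Carrier → ℕ → Carrier
  pow y zero    = 1#
  pow y (suc k) = pow y k * y

  signed : ℕ → Carrier → Carrier
  signed zero    v = v
  signed (suc k) v = - signed k v

  det : (n : ℕ) → (Fin n → Fin n → Carrier) → Carrier
  det zero    M = 1#
  det (suc n) M =
    sumFin (suc n) (λ j → signed (toℕ j)
      (M Fin.zero j * det n (λ i k → M (Fin.suc i) (punchIn j k))))

  -- Formal power series in t, as coefficient sequences; [t^m]F = F m.
  Series : Set c
  Series = ℕ → Carrier

  _⊛_ : Series → Series → Series
  (f ⊛ g) m = sumUpTo (suc m) (λ k → f k * g (m ∸ k))

  _⊕_ : Series → Series → Series
  (f ⊕ g) m = f m + g m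

  _⊖_ : Series → Series → Series
  (f ⊖ g) m = f m + - g m

  oneS : Series
  oneS zero    = 1#
  oneS (suc _) = 0#

  zeroS : Series
  zeroS _ = 0#

  geom : Carrier → Series
  geom y k = pow y k

  lin : Carrier → Series
  lin b zero          = 1#
  lin b (suc zero)    = b
  lin b (suc (suc _)) = 0#

  oneMinusT² : Series
  oneMinusT² zero                = 1#
  oneMinusT² (suc zero)          = 0#
  oneMinusT² (suc (suc zero))    = - 1#
  oneMinusT² (suc (suc (suc _))) = 0#

  prodS : ℕ → (ℕ → Series) → Series
  prodS zero    f = oneS
  prodS (suc m) f = prodS m f ⊛ f m

  prodList : List Series → Series
  prodList []       = oneS
  prodList (s ∷ ss) = s ⊛ prodList ss

  -- The sequence a = (a_1, a_2, ...) is given as  a : ℕ → Carrier  with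
  -- a k standing for a_{k+1}.

  fpow : Carrier → (ℕ → Carrier) → ℕ → Carrier
  fpow y a m = prodUpTo m (λ k → y + a k)

  aProd : (ℕ → Carrier) → ℕ → Series
  aProd a N = prodS N (λ k → lin (a k))

  hgl : List Carrier → (ℕ → Carrier) → ℤ → Carrier
  hgl ys a -[1+ _ ] = 0#
  hgl ys a (+ m)    =
    (prodList (List.map geom ys) ⊛ aProd a (length ys ℕ.+ m ∸ 1)) m

  geom² : Carrier × Carrier → Series
  geom² (y , yb) = geom y ⊛ geom yb

  hsp : List (Carrier × Carrier) → (ℕ → Carrier) → ℤ → Carrier
  hsp ys a -[1+ _ ] = 0#
  hsp ys a (+ m)    =
    (prodList (List.map geom² ys) ⊛ aProd a (length ys ℕ.+ m ∸ 1)) m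

  hoo : List (Carrier × Carrier) → (ℕ → Carrier) → ℤ → Carrier
  hoo ys a -[1+ _ ] = 0#
  hoo ys a (+ m)    =
    ((lin 1# ⊛ prodList (List.map geom² ys)) ⊛ aProd a (length ys ℕ.+ m ∸ 1)) m

  δ0 : ℕ → Series
  δ0 zero    = oneS
  δ0 (suc _) = zeroS

  heo : List (Carrier × Carrier) → (ℕ → Carrier) → ℤ → Carrier
  heo ys a -[1+ _ ] = 0#
  heo [] a (+ m) =
    (prodList [] ⊛ aProd a (length {A = Carrier × Carrier} [] ℕ.+ m ∸ 1)) m
  heo ((y , yb) ∷ []) a (+ m) =
    (((geom y ⊕ geom yb) ⊖ δ0 m) ⊛ aProd a m) m
  heo ys@(_ ∷ _ ∷ _) a (+ m) =
    ((oneMinusT² ⊛ prodList (List.map geom² ys)) ⊛ aProd a (length ys ℕ.+ m ∸ 1)) m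

  IsPartition : (n : ℕ) → (Fin n → ℕ) → Set
  IsPartition n lam = ∀ (i j : Fin n) → i Fin.≤ j → lam j ℕ.≤ lam i

  -- exponent λ_j + n - j (1-based j), for 0-based j
  ex : (n : ℕ) → (Fin n → ℕ) → Fin n → ℕ
  ex n lam j = lam j ℕ.+ (n ∸ suc (toℕ j))

  idx : {n : ℕ} → (Fin n → ℕ) → Fin n → Fin n → ℤ
  idx lam i j = (+ lam j) ℤ.- (+ toℕ j) ℤ.+ (+ toℕ i)

  zero-part : {n : ℕ} → (Fin n → ℕ) → Fin n → ℕ
  zero-part _ _ = 0

  -- variables x^{(i)} = (x_i,...,x_n) (0-based i: drop the first i)
  tail-from : {n : ℕ} {A : Set c} → (Fin n → A) → Fin n → List A
  tail-from {n} x i = drop (toℕ i) (List.tabulate x)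

  pairUp : {n : ℕ} → (Fin n → Carrier) → (Fin n → Carrier) → Fin n → Carrier × Carrier
  pairUp x xb i = x i , xb i

  -- numerators / denominators of the factorial characters
  glDet : (n : ℕ) → (Fin n → Carrier) → (ℕ → Carrier) → (Fin n → ℕ) → Carrier
  glDet n x a lam = det n (λ i j → fpow (x i) a (ex n lam j))

  spDet : (n : ℕ) → (Fin n → Carrier) → (Fin n → Carrier) → (ℕ → Carrier) → (Fin n → ℕ) → Carrier
  spDet n x xb a lam =
    det n (λ i j → x i * fpow (x i) a (ex n lam j) + - (xb i * fpow (xb i) a (ex n lam j)))

  -- z i plays the role of x_i^{1/2}, zb i of xbar_i^{1/2}; x_i = z_i^2, xbar_i = zb_i^2
  soDet : (n : ℕ) → (Fin n → Carrier) → (Fin n → Carrier) → (ℕ → Carrier) → (Fin n → ℕ) → Carrier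
  soDet n z zb a lam =
    det n (λ i j → z i * fpow (z i * z i) a (ex n lam j)
                   + - (zb i * fpow (zb i * zb i) a (ex n lam j)))

  oDet : (n : ℕ) → (Fin n → Carrier) → (Fin n → Carrier) → (ℕ → Carrier) → (Fin n → ℕ) → Carrier
  oDet n x xb a lam =
    det n (λ i j → fpow (x i) a (ex n lam j) + fpow (xb i) a (ex n lam j))

  -- 2η·N, where η = 1/2 if λ_n = 0 and η = 1 if λ_n > 0
  twoEta : ℕ → Carrier → Carrier
  twoEta zero    v = v
  twoEta (suc _) v = v + v

  glJT : (n : ℕ) → (Fin n → Carrier) → (ℕ → Carrier) → (Fin n → ℕ) → Carrier
  glJT n x a lam = det n (λ i j → hgl (tail-from x i) a (idx lam i j))

  spJT : (n : ℕ) → (Fin n → Carrier) → (Fin n → Carrier) → (ℕ → Carrier) → (Fin n → ℕ) → Carrier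
  spJT n x xb a lam = det n (λ i j → hsp (tail-from (pairUp x xb) i) a (idx lam i j))

  ooJT : (n : ℕ) → (Fin n → Carrier) → (Fin n → Carrier) → (ℕ → Carrier) → (Fin n → ℕ) → Carrier
  ooJT n x xb a lam = det n (λ i j → hoo (tail-from (pairUp x xb) i) a (idx lam i j))

  eoJT : (n : ℕ) → (Fin n → Carrier) → (Fin n → Carrier) → (ℕ → Carrier) → (Fin n → ℕ) → Carrier
  eoJT n x xb a lam = det n (λ i j → heo (tail-from (pairUp x xb) i) a (idx lam i j))

-- Each numerator is a determinant det (r_i h_{λ_j+n-j}(x_i)) for a family h_m(S), the coefficient of t^m
-- in a product of power series, and every family obeys h_{m+1}(y,T) = h_{m+1}(s,T) + δ(y,s) h_m(y,s,T),
-- a consequence of 1/(1-ty) - 1/(1-ts) = (y-s) t / ((1-ty)(1-ts)).  Iterating this recurrence (Newton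
-- interpolation) writes row i of the numerator as an upper triangular combination of the rows
-- h_{λ_j-j+k}(x^{(k)}), so numerator(λ) = D · JT(λ) with D independent of λ.  At λ = 0 the Jacobi–Trudi
-- matrix is unitriangular, hence D = numerator(0), the Weyl denominator.  In the even orthogonal case
-- the one-variable series has constant term 2 where h^{eo}_0 = 1; this is where the factor 2η comes from.
module Submission where

open import Defs
open import Level using (Level; _⊔_)
open import Algebra.Bundles using (CommutativeRing)
import Algebra.Properties.Ring as RingProperties
import Algebra.Properties.Semiring.Mult.TCOptimised as SemiringMult
import Algebra.Solver.Ring.AlmostCommutativeRing as ACR
open import Data.Empty using (⊥-elim)
open import Data.Fin as Fin using (Fin; toℕ; punchIn; fromℕ; inject₁)
import Data.Fin.Properties as Fin
open import Data.Integer as ℤ using (ℤ; +_; -[1+_])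
import Data.Integer.Properties as ℤ
open import Data.Integer.Tactic.RingSolver using (solve-∀)
open import Data.List as List using (List; []; _∷_; length; drop; _++_)
import Data.List.Properties as List
open import Data.Maybe using (Maybe; just; nothing)
open import Data.Nat as ℕ using (ℕ; zero; suc; _∸_; z≤n; s≤s)
import Data.Nat.Properties as ℕ
open import Data.Product using (Σ; ∃; _×_; _,_; proj₁; proj₂)
open import Relation.Nullary using (yes; no)
open import Relation.Binary.PropositionalEquality as ≡ using (_≡_; _≢_)

private
  suc-+-assoc : ∀ (i j : ℤ) → (ℤ.1ℤ ℤ.+ i) ℤ.+ j ≡ i ℤ.+ (ℤ.1ℤ ℤ.+ j)
  suc-+-assoc = solve-∀

  exponent-identity : ∀ (L J K : ℤ) → ((ℤ.1ℤ ℤ.+ J) ℤ.+ K) ℤ.+ (ℤ.-1ℤ ℤ.+ (L ℤ.- J)) ≡ L ℤ.+ K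
  exponent-identity = solve-∀

  below-identity : ∀ (J K : ℤ) → (ℤ.0ℤ ℤ.- ((ℤ.1ℤ ℤ.+ K) ℤ.+ J)) ℤ.+ K ≡ ℤ.- (ℤ.1ℤ ℤ.+ J)
  below-identity = solve-∀

  diagonal-identity : ∀ (J : ℤ) → (ℤ.0ℤ ℤ.- J) ℤ.+ J ≡ ℤ.0ℤ
  diagonal-identity = solve-∀

  last-identity : ∀ (N B : ℤ) → (ℤ.1ℤ ℤ.+ N) ℤ.+ (ℤ.-1ℤ ℤ.+ B) ≡ B ℤ.+ N
  last-identity = solve-∀

punchIn-inject₁-fromℕ : ∀ {n} (j : Fin (suc n)) → punchIn (inject₁ j) (fromℕ n) ≡ fromℕ (suc n)
punchIn-inject₁-fromℕ Fin.zero = ≡.refl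
punchIn-inject₁-fromℕ {suc n} (Fin.suc j) = ≡.cong Fin.suc (punchIn-inject₁-fromℕ j)

punchIn-inject₁ : ∀ {n} (j : Fin (suc n)) (k : Fin n) → punchIn (inject₁ j) (inject₁ k) ≡ inject₁ (punchIn j k)
punchIn-inject₁ Fin.zero k = ≡.refl
punchIn-inject₁ (Fin.suc j) Fin.zero = ≡.refl
punchIn-inject₁ (Fin.suc j) (Fin.suc k) = ≡.cong Fin.suc (punchIn-inject₁ j k)

drop-tabulate : ∀ {a} {A : Set a} N (xs : Fin N → A) k →
  drop (toℕ k) (List.tabulate xs) ≡ xs k ∷ drop (suc (toℕ k)) (List.tabulate xs)
drop-tabulate (suc N) xs Fin.zero    = ≡.refl
drop-tabulate (suc N) xs (Fin.suc k) = drop-tabulate N (λ i → xs (Fin.suc i)) k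

drop-tabulate-length : ∀ {a} {A : Set a} n (xs : Fin (suc n) → A) → drop (suc n) (List.tabulate xs) ≡ []
drop-tabulate-length zero    xs = ≡.refl
drop-tabulate-length (suc n) xs = drop-tabulate-length n (λ i → xs (Fin.suc i))

drop-tabulate-last : ∀ {a} {A : Set a} n (xs : Fin (suc n) → A) → drop (toℕ (fromℕ n)) (List.tabulate xs) ≡ xs (fromℕ n) ∷ []
drop-tabulate-last n xs = ≡.trans (drop-tabulate (suc n) xs (fromℕ n))
  (≡.cong (xs (fromℕ n) ∷_) (≡.trans (≡.cong (λ m → drop (suc m) (List.tabulate xs)) (Fin.toℕ-fromℕ n)) (drop-tabulate-length n xs)))

drop-tabulate-empty : ∀ {a} {A : Set a} n (xs : Fin (suc n) → A) k → drop (suc (toℕ k)) (List.tabulate xs) ≡ [] → toℕ k ≡ n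
drop-tabulate-empty n xs k empty = ℕ.≤-antisym (Fin.toℕ≤pred[n] {suc n} k) (ℕ.m∸n≡0⇒m≤n n∸k≡0)
  where
  n∸k≡0 : n ℕ.∸ toℕ k ≡ 0
  n∸k≡0 = ≡.trans (≡.sym (≡.cong (ℕ._∸ suc (toℕ k)) (List.length-tabulate xs)))
          (≡.trans (≡.sym (List.length-drop (suc (toℕ k)) (List.tabulate xs))) (≡.cong List.length empty))

map-drop-tabulate : ∀ {a b} {A : Set a} {B : Set b} N (xs : Fin N → A) (f : A → B) k →
  List.map f (drop k (List.tabulate xs)) ≡ drop k (List.tabulate (λ i → f (xs i)))
map-drop-tabulate N xs f k = ≡.trans (≡.sym (List.drop-map k (List.tabulate xs))) (≡.cong (drop k) (List.map-tabulate xs f))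

-- The standard ring solver needs coefficients with decidable equality, which an abstract commutative
-- ring lacks; integer coefficients, mapped into the ring, serve instead.
module IntegerCoefficientSolver {c ℓ : Level} (R : CommutativeRing c ℓ) where
  open CommutativeRing R
  open RingProperties ring
  open SemiringMult semiring using (×-homo-+; ×1-homo-*) renaming (_×_ to _×′_)
  open import Relation.Binary.Reasoning.Setoid setoid

  fromℤ : ℤ → Carrier
  fromℤ (+ n)      = n ×′ 1#
  fromℤ -[1+ n ]   = - (suc n ×′ 1#)

  fromℤ-neg : ∀ i → fromℤ (ℤ.- i) ≈ - fromℤ i
  fromℤ-neg -[1+ n ]    = sym (-‿involutive _)
  fromℤ-neg (+ zero)    = sym -0#≈0#
  fromℤ-neg (+ (suc n)) = refl

  fromℤ-⊖ : ∀ m n → fromℤ (m ℤ.⊖ n) ≈ m ×′ 1# - n ×′ 1#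
  fromℤ-⊖ m       zero    = sym (trans (+-congˡ -0#≈0#) (+-identityʳ _))
  fromℤ-⊖ zero    (suc n) = sym (+-identityˡ _)
  fromℤ-⊖ (suc m) (suc n) = begin
    fromℤ (suc m ℤ.⊖ suc n)           ≈⟨ reflexive (≡.cong fromℤ (ℤ.[1+m]⊖[1+n]≡m⊖n m n)) ⟩
    fromℤ (m ℤ.⊖ n)                   ≈⟨ fromℤ-⊖ m n ⟩
    m ×′ 1# - n ×′ 1#                 ≈⟨ cancel (m ×′ 1#) (n ×′ 1#) ⟩
    (1# + m ×′ 1#) - (1# + n ×′ 1#)   ≈⟨ sym (+-cong (×-homo-+ 1# 1 m) (-‿cong (×-homo-+ 1# 1 n))) ⟩
    suc m ×′ 1# - suc n ×′ 1#         ∎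
    where
    cancel : ∀ x y → x - y ≈ (1# + x) - (1# + y)
    cancel x y = begin
      x - y                       ≈⟨ sym (+-identityˡ _) ⟩
      0# + (x - y)                ≈⟨ +-congʳ (sym (-‿inverseʳ 1#)) ⟩
      (1# - 1#) + (x - y)         ≈⟨ +-assoc _ _ _ ⟩
      1# + (- 1# + (x - y))       ≈⟨ +-congˡ (trans (+-congˡ (+-comm _ _)) (sym (+-assoc _ _ _))) ⟩
      1# + ((- 1# + - y) + x)     ≈⟨ +-congˡ (+-comm _ _) ⟩
      1# + (x + (- 1# + - y))     ≈⟨ sym (+-assoc _ _ _) ⟩
      (1# + x) + (- 1# + - y)     ≈⟨ +-congˡ (-‿+-comm 1# y) ⟩
      (1# + x) - (1# + y)         ∎

  fromℤ-+ : ∀ i j → fromℤ (i ℤ.+ j) ≈ fromℤ i + fromℤ j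
  fromℤ-+ (+ m)      (+ n)      = ×-homo-+ 1# m n
  fromℤ-+ (+ m)      -[1+ n ]   = fromℤ-⊖ m (suc n)
  fromℤ-+ -[1+ m ]   (+ n)      = trans (fromℤ-⊖ n (suc m)) (+-comm _ _)
  fromℤ-+ -[1+ m ]   -[1+ n ]   = begin
    fromℤ (-[1+ m ] ℤ.+ -[1+ n ])      ≈⟨ reflexive (≡.cong fromℤ (≡.sym (ℤ.neg-distrib-+ (+ suc m) (+ suc n)))) ⟩
    fromℤ (ℤ.- (+ suc m ℤ.+ + suc n))  ≈⟨ fromℤ-neg (+ suc m ℤ.+ + suc n) ⟩
    - ((suc m ℕ.+ suc n) ×′ 1#)        ≈⟨ -‿cong (×-homo-+ 1# (suc m) (suc n)) ⟩
    - (suc m ×′ 1# + suc n ×′ 1#)      ≈⟨ sym (-‿+-comm _ _) ⟩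
    fromℤ -[1+ m ] + fromℤ -[1+ n ]    ∎

  fromℤ-*-pos : ∀ m j → fromℤ (+ m ℤ.* j) ≈ fromℤ (+ m) * fromℤ j
  fromℤ-*-pos m (+ n) = trans (reflexive (≡.cong fromℤ (≡.sym (ℤ.pos-* m n)))) (×1-homo-* m n)
  fromℤ-*-pos m -[1+ n ] = begin
    fromℤ (+ m ℤ.* ℤ.- + suc n)        ≈⟨ reflexive (≡.cong fromℤ (≡.sym (ℤ.neg-distribʳ-* (+ m) (+ suc n)))) ⟩
    fromℤ (ℤ.- (+ m ℤ.* + suc n))      ≈⟨ fromℤ-neg (+ m ℤ.* + suc n) ⟩
    - fromℤ (+ m ℤ.* + suc n)          ≈⟨ -‿cong (fromℤ-*-pos m (+ suc n)) ⟩
    - (fromℤ (+ m) * fromℤ (+ suc n))  ≈⟨ -‿distribʳ-* _ _ ⟩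
    fromℤ (+ m) * fromℤ -[1+ n ]       ∎

  fromℤ-* : ∀ i j → fromℤ (i ℤ.* j) ≈ fromℤ i * fromℤ j
  fromℤ-* (+ m)    j = fromℤ-*-pos m j
  fromℤ-* -[1+ m ] j = begin
    fromℤ (ℤ.- + suc m ℤ.* j)      ≈⟨ reflexive (≡.cong fromℤ (≡.sym (ℤ.neg-distribˡ-* (+ suc m) j))) ⟩
    fromℤ (ℤ.- (+ suc m ℤ.* j))    ≈⟨ fromℤ-neg (+ suc m ℤ.* j) ⟩
    - fromℤ (+ suc m ℤ.* j)        ≈⟨ -‿cong (fromℤ-*-pos (suc m) j) ⟩
    - (fromℤ (+ suc m) * fromℤ j)  ≈⟨ -‿distribˡ-* _ _ ⟩
    fromℤ -[1+ m ] * fromℤ j       ∎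

  almostCommutativeRing : ACR.AlmostCommutativeRing c ℓ
  almostCommutativeRing = ACR.fromCommutativeRing R

  integerMorphism : ℤ.+-*-rawRing ACR.-Raw-AlmostCommutative⟶ almostCommutativeRing
  integerMorphism = record
    { ⟦_⟧ = fromℤ ; +-homo = fromℤ-+ ; *-homo = fromℤ-* ; -‿homo = fromℤ-neg
    ; 0-homo = refl ; 1-homo = refl }

  coefficientsEqual? : ∀ i j → Maybe (fromℤ i ≈ fromℤ j)
  coefficientsEqual? i j with i ℤ.≟ j
  ... | yes ≡.refl = just refl
  ... | no _       = nothing

  open import Algebra.Solver.Ring ℤ.+-*-rawRing almostCommutativeRing integerMorphism coefficientsEqual? public

module Determinants {c ℓ : Level} (R : CommutativeRing c ℓ) where
  open CommutativeRing R hiding (zero)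
  open RingProperties ring using (-0#≈0#; -‿+-comm; -‿distribˡ-*)
  open Factorial R
  open IntegerCoefficientSolver R using (solve; _:+_; _:*_; :-_; _:=_; con)
  open import Relation.Binary.Reasoning.Setoid setoid

  sumFin-cong : ∀ n {f g : Fin n → Carrier} → (∀ i → f i ≈ g i) → sumFin n f ≈ sumFin n g
  sumFin-cong zero    f≈g = refl
  sumFin-cong (suc n) f≈g = +-cong (f≈g Fin.zero) (sumFin-cong n (λ i → f≈g (Fin.suc i)))

  sumFin-zero : ∀ n {f : Fin n → Carrier} → (∀ i → f i ≈ 0#) → sumFin n f ≈ 0#
  sumFin-zero zero    f≈0 = refl
  sumFin-zero (suc n) f≈0 = trans (+-cong (f≈0 Fin.zero) (sumFin-zero n (λ i → f≈0 (Fin.suc i)))) (+-identityʳ 0#)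

  sumFin-+ : ∀ n (f g : Fin n → Carrier) → sumFin n (λ i → f i + g i) ≈ sumFin n f + sumFin n g
  sumFin-+ zero    f g = sym (+-identityʳ 0#)
  sumFin-+ (suc n) f g = trans (+-congˡ (sumFin-+ n _ _))
    (solve 4 (λ a b d e → (a :+ b) :+ (d :+ e) := (a :+ d) :+ (b :+ e)) refl _ _ _ _)

  sumFin-*ˡ : ∀ n a (f : Fin n → Carrier) → a * sumFin n f ≈ sumFin n (λ i → a * f i)
  sumFin-*ˡ zero    a f = zeroʳ a
  sumFin-*ˡ (suc n) a f = trans (distribˡ _ _ _) (+-congˡ (sumFin-*ˡ n a _))

  sumFin-*ʳ : ∀ n a (f : Fin n → Carrier) → sumFin n f * a ≈ sumFin n (λ i → f i * a)
  sumFin-*ʳ n a f = trans (*-comm _ _) (trans (sumFin-*ˡ n a f) (sumFin-cong n (λ i → *-comm _ _)))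

  sumFin-neg : ∀ n (f : Fin n → Carrier) → - sumFin n f ≈ sumFin n (λ i → - f i)
  sumFin-neg zero    f = -0#≈0#
  sumFin-neg (suc n) f = trans (sym (-‿+-comm _ _)) (+-congˡ (sumFin-neg n _))

  sumFin-swap : ∀ n m (f : Fin n → Fin m → Carrier) →
    sumFin n (λ i → sumFin m (f i)) ≈ sumFin m (λ j → sumFin n (λ i → f i j))
  sumFin-swap zero    m f = sym (sumFin-zero m (λ _ → refl))
  sumFin-swap (suc n) m f = trans (+-congˡ (sumFin-swap n m _)) (sym (sumFin-+ m _ _))

  sumFin-last : ∀ n (f : Fin (suc n) → Carrier) → sumFin (suc n) f ≈ sumFin n (λ i → f (inject₁ i)) + f (fromℕ n)
  sumFin-last zero    f = trans (+-identityʳ _) (sym (+-identityˡ _))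
  sumFin-last (suc n) f = trans (+-congˡ (sumFin-last n (λ i → f (Fin.suc i)))) (sym (+-assoc _ _ _))

  sign : ℕ → Carrier
  sign k = signed k 1#

  signed≈sign* : ∀ k x → signed k x ≈ sign k * x
  signed≈sign* zero    x = sym (*-identityˡ x)
  signed≈sign* (suc k) x = trans (-‿cong (signed≈sign* k x)) (-‿distribˡ-* _ _)

  signed-cong : ∀ k {x y} → x ≈ y → signed k x ≈ signed k y
  signed-cong zero    x≈y = x≈y
  signed-cong (suc k) x≈y = -‿cong (signed-cong k x≈y)

  signed-zero : ∀ k {x} → x ≈ 0# → signed k x ≈ 0#
  signed-zero zero    x≈0 = x≈0
  signed-zero (suc k) x≈0 = trans (-‿cong (signed-zero k x≈0)) -0#≈0#

  det-cong : ∀ n {M N : Fin n → Fin n → Carrier} → (∀ i j → M i j ≈ N i j) → det n M ≈ det n N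
  det-cong zero    M≈N = refl
  det-cong (suc n) M≈N = sumFin-cong (suc n) (λ j → signed-cong (toℕ j)
    (*-cong (M≈N Fin.zero j) (det-cong n (λ i k → M≈N (Fin.suc i) (punchIn j k)))))

  -- The minors left by a two-row expansion are indexed by column selections; without function
  -- extensionality we can only assume they respect pointwise equality of the selection.
  Respects≗ : ∀ {m k} → ((Fin m → Fin k) → Carrier) → Set ℓ
  Respects≗ G = ∀ σ τ → (∀ i → σ i ≡ τ i) → G σ ≈ G τ

  lift : ∀ {m k} → (Fin m → Fin k) → Fin (suc m) → Fin (suc k)
  lift σ Fin.zero    = Fin.zero
  lift σ (Fin.suc i) = Fin.suc (σ i)

  Respects≗-lift : ∀ {m k} (G : (Fin (suc m) → Fin (suc k)) → Carrier) → Respects≗ G → Respects≗ (λ τ → G (lift τ))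
  Respects≗-lift G resp σ τ σ≗τ = resp _ _ λ { Fin.zero → ≡.refl ; (Fin.suc i) → ≡.cong Fin.suc (σ≗τ i) }

  expandTwoRows : (m : ℕ) → (u v : Fin (suc (suc m)) → Carrier) → ((Fin m → Fin (suc (suc m))) → Carrier) → Carrier
  expandTwoRows m u v G = sumFin (suc (suc m)) (λ j → signed (toℕ j) (u j *
    sumFin (suc m) (λ j′ → signed (toℕ j′) (v (punchIn j j′) * G (λ k → punchIn j (punchIn j′ k))))))

  expandRowAfterColumn₀ : (m : ℕ) → (w : Fin (suc (suc (suc m))) → Carrier) →
    ((Fin (suc m) → Fin (suc (suc (suc m)))) → Carrier) → Carrier
  expandRowAfterColumn₀ m w G = sumFin (suc (suc m)) (λ j → signed (toℕ j) (w (Fin.suc j) * G (λ k → Fin.suc (punchIn j k))))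

  -- Split the two-row expansion according to which of the two rows (if any) uses column 0.
  expandTwoRows-column₀ : ∀ m u v G → Respects≗ G → expandTwoRows (suc m) u v G ≈
    u Fin.zero * expandRowAfterColumn₀ m v G
    + (- (v Fin.zero * expandRowAfterColumn₀ m u G)
       + expandTwoRows m (λ i → u (Fin.suc i)) (λ i → v (Fin.suc i)) (λ τ → G (lift τ)))
  expandTwoRows-column₀ m u v G resp = +-congˡ (begin
    sumFin (suc (suc m)) (λ k → - signed (toℕ k) (u (Fin.suc k) * rowV k))
      ≈⟨ sumFin-cong (suc (suc m)) (λ k → -‿cong (signed-cong (toℕ k) (*-congˡ {u (Fin.suc k)} (rowV-column₀ k)))) ⟩
    sumFin (suc (suc m)) (λ k → - signed (toℕ k) (u (Fin.suc k) * (v Fin.zero * g k - rest k)))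
      ≈⟨ sumFin-cong (suc (suc m)) regroup ⟩
    sumFin (suc (suc m)) (λ k → - (v Fin.zero * signed (toℕ k) (u (Fin.suc k) * g k)) + signed (toℕ k) (u′ k * rest k))
      ≈⟨ sumFin-+ (suc (suc m)) (λ k → - (v Fin.zero * gTerm k)) (λ k → signed (toℕ k) (u′ k * rest k)) ⟩
    sumFin (suc (suc m)) (λ k → - (v Fin.zero * gTerm k)) + expandTwoRows m u′ v′ G′
      ≈⟨ +-congʳ (trans (sym (sumFin-neg (suc (suc m)) (λ k → v Fin.zero * gTerm k)))
                        (-‿cong (sym (sumFin-*ˡ (suc (suc m)) (v Fin.zero) gTerm)))) ⟩
    - (v Fin.zero * expandRowAfterColumn₀ m u G) + expandTwoRows m u′ v′ G′ ∎)
    where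
    u′ v′ : Fin (suc (suc m)) → Carrier
    u′ i = u (Fin.suc i)
    v′ i = v (Fin.suc i)
    G′ : (Fin m → Fin (suc (suc m))) → Carrier
    G′ τ = G (lift τ)
    rowV : Fin (suc (suc m)) → Carrier
    rowV k = sumFin (suc (suc m)) (λ j′ → signed (toℕ j′) (v (punchIn (Fin.suc k) j′) * G (λ l → punchIn (Fin.suc k) (punchIn j′ l))))
    g rest gTerm : Fin (suc (suc m)) → Carrier
    g k = G (λ l → Fin.suc (punchIn k l))
    gTerm k = signed (toℕ k) (u (Fin.suc k) * g k)
    rest k = sumFin (suc m) (λ j′ → signed (toℕ j′) (v′ (punchIn k j′) * G′ (λ l → punchIn k (punchIn j′ l))))
    rowV-column₀ : ∀ k → rowV k ≈ v Fin.zero * g k - rest k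
    rowV-column₀ k = +-congˡ (trans
      (sumFin-cong (suc m) (λ j′ → -‿cong (signed-cong (toℕ j′) (*-congˡ {v (Fin.suc (punchIn k j′))}
        (resp (λ l → punchIn (Fin.suc k) (punchIn (Fin.suc j′) l)) (lift (λ l → punchIn k (punchIn j′ l)))
              λ { Fin.zero → ≡.refl ; (Fin.suc l) → ≡.refl })))))
      (sym (sumFin-neg (suc m) (λ j′ → signed (toℕ j′) (v′ (punchIn k j′) * G′ (λ l → punchIn k (punchIn j′ l)))))))
    regroup : ∀ k → - signed (toℕ k) (u (Fin.suc k) * (v Fin.zero * g k - rest k))
                    ≈ - (v Fin.zero * signed (toℕ k) (u (Fin.suc k) * g k)) + signed (toℕ k) (u′ k * rest k)
    regroup k = begin
      - signed (toℕ k) (u (Fin.suc k) * (v Fin.zero * g k - rest k))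
        ≈⟨ -‿cong (signed≈sign* (toℕ k) _) ⟩
      - (sign (toℕ k) * (u (Fin.suc k) * (v Fin.zero * g k - rest k)))
        ≈⟨ solve 5 (λ s a b h r → :- (s :* (a :* (b :* h :+ :- r))) := :- (b :* (s :* (a :* h))) :+ s :* (a :* r)) refl _ _ _ _ _ ⟩
      - (v Fin.zero * (sign (toℕ k) * (u (Fin.suc k) * g k))) + sign (toℕ k) * (u′ k * rest k)
        ≈⟨ sym (+-cong (-‿cong (*-congˡ (signed≈sign* (toℕ k) _))) (signed≈sign* (toℕ k) _)) ⟩
      - (v Fin.zero * signed (toℕ k) (u (Fin.suc k) * g k)) + signed (toℕ k) (u′ k * rest k) ∎

  expandTwoRows-2×2 : ∀ u v G → Respects≗ G → expandTwoRows 0 u v G ≈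
    u Fin.zero * (v (Fin.suc Fin.zero) * G (λ ()) + 0#) + (- (u (Fin.suc Fin.zero) * (v Fin.zero * G (λ ()) + 0#)) + 0#)
  expandTwoRows-2×2 u v G resp =
    +-cong (*-congˡ (+-congʳ (*-congˡ (resp _ _ λ ()))))
           (+-congʳ (-‿cong (*-congˡ (+-congʳ (*-congˡ (resp _ _ λ ()))))))

  expandTwoRows-antisym : ∀ m u v G → Respects≗ G → expandTwoRows m u v G ≈ - expandTwoRows m v u G
  expandTwoRows-antisym zero u v G resp = begin
    expandTwoRows 0 u v G
      ≈⟨ expandTwoRows-2×2 u v G resp ⟩
    u Fin.zero * (v (Fin.suc Fin.zero) * G (λ ()) + 0#) + (- (u (Fin.suc Fin.zero) * (v Fin.zero * G (λ ()) + 0#)) + 0#)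
      ≈⟨ solve 5 (λ u₀ u₁ v₀ v₁ d → u₀ :* (v₁ :* d :+ con (+ 0)) :+ (:- (u₁ :* (v₀ :* d :+ con (+ 0))) :+ con (+ 0))
                  := :- (v₀ :* (u₁ :* d :+ con (+ 0)) :+ (:- (v₁ :* (u₀ :* d :+ con (+ 0))) :+ con (+ 0)))) refl _ _ _ _ _ ⟩
    - (v Fin.zero * (u (Fin.suc Fin.zero) * G (λ ()) + 0#) + (- (v (Fin.suc Fin.zero) * (u Fin.zero * G (λ ()) + 0#)) + 0#))
      ≈⟨ -‿cong (sym (expandTwoRows-2×2 v u G resp)) ⟩
    - expandTwoRows 0 v u G ∎
  expandTwoRows-antisym (suc m) u v G resp = begin
    expandTwoRows (suc m) u v G
      ≈⟨ expandTwoRows-column₀ m u v G resp ⟩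
    u Fin.zero * expandRowAfterColumn₀ m v G + (- (v Fin.zero * expandRowAfterColumn₀ m u G) + expandTwoRows m u′ v′ G′)
      ≈⟨ +-congˡ (+-congˡ (expandTwoRows-antisym m u′ v′ G′ (Respects≗-lift G resp))) ⟩
    u Fin.zero * expandRowAfterColumn₀ m v G + (- (v Fin.zero * expandRowAfterColumn₀ m u G) + - expandTwoRows m v′ u′ G′)
      ≈⟨ solve 3 (λ a b d → a :+ (:- b :+ :- d) := :- (b :+ (:- a :+ d))) refl _ _ _ ⟩
    - (v Fin.zero * expandRowAfterColumn₀ m u G + (- (u Fin.zero * expandRowAfterColumn₀ m v G) + expandTwoRows m v′ u′ G′))
      ≈⟨ -‿cong (sym (expandTwoRows-column₀ m v u G resp)) ⟩
    - expandTwoRows (suc m) v u G ∎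
    where
    u′ v′ : Fin (suc (suc m)) → Carrier
    u′ i = u (Fin.suc i)
    v′ i = v (Fin.suc i)
    G′ : (Fin m → Fin (suc (suc m))) → Carrier
    G′ τ = G (lift τ)

  expandTwoRows-equal : ∀ m u G → Respects≗ G → expandTwoRows m u u G ≈ 0#
  expandTwoRows-equal zero u G resp = trans (expandTwoRows-2×2 u u G resp)
    (solve 3 (λ u₀ u₁ d → u₀ :* (u₁ :* d :+ con (+ 0)) :+ (:- (u₁ :* (u₀ :* d :+ con (+ 0))) :+ con (+ 0)) := con (+ 0)) refl _ _ _)
  expandTwoRows-equal (suc m) u G resp = begin
    expandTwoRows (suc m) u u G
      ≈⟨ expandTwoRows-column₀ m u u G resp ⟩
    u Fin.zero * expandRowAfterColumn₀ m u G + (- (u Fin.zero * expandRowAfterColumn₀ m u G) + expandTwoRows m u′ u′ (λ τ → G (lift τ)))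
      ≈⟨ +-congˡ (+-congˡ (expandTwoRows-equal m u′ (λ τ → G (lift τ)) (Respects≗-lift G resp))) ⟩
    u Fin.zero * expandRowAfterColumn₀ m u G + (- (u Fin.zero * expandRowAfterColumn₀ m u G) + 0#)
      ≈⟨ solve 1 (λ a → a :+ (:- a :+ con (+ 0)) := con (+ 0)) refl _ ⟩
    0# ∎
    where
    u′ : Fin (suc (suc m)) → Carrier
    u′ i = u (Fin.suc i)

  minor-respects≗ : ∀ m (M : Fin (suc (suc m)) → Fin (suc (suc m)) → Carrier) →
    Respects≗ {m} (λ σ → det m (λ i k → M (Fin.suc (Fin.suc i)) (σ k)))
  minor-respects≗ m M σ τ σ≗τ = det-cong m (λ i k → reflexive (≡.cong (M _) (σ≗τ k)))

  swapFirstRows : ∀ {m} {A : Set c} → (Fin (suc (suc m)) → A) → Fin (suc (suc m)) → A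
  swapFirstRows M Fin.zero                 = M (Fin.suc Fin.zero)
  swapFirstRows M (Fin.suc Fin.zero)       = M Fin.zero
  swapFirstRows M (Fin.suc (Fin.suc i))    = M (Fin.suc (Fin.suc i))

  det-swapFirstRows : ∀ m M → det (suc (suc m)) M ≈ - det (suc (suc m)) (swapFirstRows M)
  det-swapFirstRows m M = expandTwoRows-antisym m (M Fin.zero) (M (Fin.suc Fin.zero)) _ (minor-respects≗ m M)

  det-equalRows : ∀ n (M : Fin n → Fin n → Carrier) (p q : Fin n) → toℕ p ℕ.< toℕ q →
    (∀ j → M p j ≈ M q j) → det n M ≈ 0#
  det-equalRows (suc zero) M Fin.zero (Fin.suc ()) _ _
  det-equalRows (suc (suc m)) M Fin.zero (Fin.suc Fin.zero) _ rows≈ =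
    trans (det-cong (suc (suc m)) {M} {M′} M≈M′) (expandTwoRows-equal m (M Fin.zero) _ (minor-respects≗ m M))
    where
    M′ : Fin (suc (suc m)) → Fin (suc (suc m)) → Carrier
    M′ (Fin.suc Fin.zero) = M Fin.zero
    M′ i                  = M i
    M≈M′ : ∀ i j → M i j ≈ M′ i j
    M≈M′ Fin.zero              j = refl
    M≈M′ (Fin.suc Fin.zero)    j = sym (rows≈ j)
    M≈M′ (Fin.suc (Fin.suc i)) j = refl
  det-equalRows (suc (suc m)) M Fin.zero (Fin.suc (Fin.suc q)) _ rows≈ =
    trans (det-swapFirstRows m M) (trans (-‿cong (sumFin-zero (suc (suc m)) (λ j → signed-zero (toℕ j)
      (trans (*-congˡ (det-equalRows (suc m) (λ i k → swapFirstRows M (Fin.suc i) (punchIn j k)) Fin.zero (Fin.suc q) (s≤s z≤n)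
        (λ k → rows≈ (punchIn j k)))) (zeroʳ (M (Fin.suc Fin.zero) j)))))) -0#≈0#)
  det-equalRows (suc n) M (Fin.suc p) (Fin.suc q) (s≤s p<q) rows≈ =
    sumFin-zero (suc n) (λ j → signed-zero (toℕ j)
      (trans (*-congˡ (det-equalRows n (λ i k → M (Fin.suc i) (punchIn j k)) p q p<q (λ k → rows≈ (punchIn j k)))) (zeroʳ (M Fin.zero j))))

  matMul : ∀ n → (Fin n → Fin n → Carrier) → (Fin n → Fin n → Carrier) → Fin n → Fin n → Carrier
  matMul n W X i j = sumFin n (λ k → W i k * X k j)

  UpperTriangular : ∀ n → (Fin n → Fin n → Carrier) → Set ℓ
  UpperTriangular n W = ∀ i k → toℕ k ℕ.< toℕ i → W i k ≈ 0#

  diagonalProduct : ∀ n → (Fin n → Fin n → Carrier) → Carrier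
  diagonalProduct zero    W = 1#
  diagonalProduct (suc n) W = W Fin.zero Fin.zero * diagonalProduct n (λ i k → W (Fin.suc i) (Fin.suc k))

  replaceFirstRow : ∀ {n} → (Fin (suc n) → Fin (suc n) → Carrier) → Fin (suc n) → Fin (suc n) → Fin (suc n) → Carrier
  replaceFirstRow X l Fin.zero    = X l
  replaceFirstRow X l (Fin.suc i) = X (Fin.suc i)

  -- Expand along the first row of W X: its entries are combinations of the rows of X, and every row
  -- other than the first gives a determinant with two equal rows.
  det-upperTriangular-matMul : ∀ n W X → UpperTriangular n W → det n (matMul n W X) ≈ diagonalProduct n W * det n X
  det-upperTriangular-matMul zero    W X _  = sym (*-identityˡ _)
  det-upperTriangular-matMul (suc n) W X ut = begin
    det (suc n) (matMul (suc n) W X)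
      ≈⟨ sumFin-cong (suc n) (λ j → signed-cong (toℕ j) (*-congˡ {row₀ j}
           (trans (det-cong n (λ i k → lowerRow i (punchIn j k))) (det-upperTriangular-matMul n W′ (minorX j) ut′)))) ⟩
    sumFin (suc n) (λ j → signed (toℕ j) (row₀ j * (d′ * D j)))
      ≈⟨ sumFin-cong (suc n) expandRow₀ ⟩
    sumFin (suc n) (λ j → sumFin (suc n) (λ l → d′ * (W Fin.zero l * signed (toℕ j) (X l j * D j))))
      ≈⟨ sumFin-swap (suc n) (suc n) (λ j l → d′ * (W Fin.zero l * signed (toℕ j) (X l j * D j))) ⟩
    sumFin (suc n) (λ l → sumFin (suc n) (λ j → d′ * (W Fin.zero l * signed (toℕ j) (X l j * D j))))
      ≈⟨ sumFin-cong (suc n) (λ l → trans (sym (sumFin-*ˡ (suc n) d′ (λ j → W Fin.zero l * signed (toℕ j) (X l j * D j))))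
           (*-congˡ (sym (sumFin-*ˡ (suc n) (W Fin.zero l) (λ j → signed (toℕ j) (X l j * D j)))))) ⟩
    sumFin (suc n) (λ l → d′ * (W Fin.zero l * det (suc n) (replaceFirstRow X l)))
      ≈⟨ +-congˡ (sumFin-zero n (λ l → trans (*-congˡ (trans (*-congˡ
           (det-equalRows (suc n) (replaceFirstRow X (Fin.suc l)) Fin.zero (Fin.suc l) (s≤s z≤n) (λ j → refl))) (zeroʳ _))) (zeroʳ _))) ⟩
    d′ * (W Fin.zero Fin.zero * det (suc n) X) + 0#
      ≈⟨ solve 3 (λ a b d → a :* (b :* d) :+ con (+ 0) := (b :* a) :* d) refl _ _ _ ⟩
    diagonalProduct (suc n) W * det (suc n) X ∎
    where
    W′ : Fin n → Fin n → Carrier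
    W′ i k = W (Fin.suc i) (Fin.suc k)
    d′ = diagonalProduct n W′
    minorX : Fin (suc n) → Fin n → Fin n → Carrier
    minorX j l k = X (Fin.suc l) (punchIn j k)
    D row₀ : Fin (suc n) → Carrier
    D j = det n (minorX j)
    row₀ j = matMul (suc n) W X Fin.zero j
    ut′ : UpperTriangular n W′
    ut′ i k k<i = ut (Fin.suc i) (Fin.suc k) (s≤s k<i)
    lowerRow : ∀ i j → matMul (suc n) W X (Fin.suc i) j ≈ sumFin n (λ l → W′ i l * X (Fin.suc l) j)
    lowerRow i j = trans (+-congʳ (trans (*-congʳ (ut (Fin.suc i) Fin.zero (s≤s z≤n))) (zeroˡ _))) (+-identityˡ _)
    expandRow₀ : ∀ j → signed (toℕ j) (row₀ j * (d′ * D j))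
                       ≈ sumFin (suc n) (λ l → d′ * (W Fin.zero l * signed (toℕ j) (X l j * D j)))
    expandRow₀ j = begin
      signed (toℕ j) (row₀ j * (d′ * D j))                ≈⟨ signed≈sign* (toℕ j) _ ⟩
      sign (toℕ j) * (row₀ j * (d′ * D j))
        ≈⟨ solve 4 (λ s a d e → s :* (a :* (d :* e)) := a :* (s :* (d :* e))) refl _ _ _ _ ⟩
      row₀ j * (sign (toℕ j) * (d′ * D j))                ≈⟨ sumFin-*ʳ (suc n) _ (λ l → W Fin.zero l * X l j) ⟩
      sumFin (suc n) (λ l → (W Fin.zero l * X l j) * (sign (toℕ j) * (d′ * D j)))
        ≈⟨ sumFin-cong (suc n) (λ l → trans
             (solve 5 (λ w x s d e → (w :* x) :* (s :* (d :* e)) := d :* (w :* (s :* (x :* e))))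
                      refl (W Fin.zero l) (X l j) (sign (toℕ j)) d′ (D j))
             (*-congˡ (*-congˡ (sym (signed≈sign* (toℕ j) _))))) ⟩
      sumFin (suc n) (λ l → d′ * (W Fin.zero l * signed (toℕ j) (X l j * D j))) ∎

  det-lowerUnitriangular : ∀ n (M : Fin n → Fin n → Carrier) →
    (∀ i k → toℕ i ℕ.< toℕ k → M i k ≈ 0#) → (∀ i → M i i ≈ 1#) → det n M ≈ 1#
  det-lowerUnitriangular zero    M _     _    = refl
  det-lowerUnitriangular (suc n) M upper diag = trans
    (+-cong (*-cong (diag Fin.zero) (det-lowerUnitriangular n (λ i k → M (Fin.suc i) (Fin.suc k))
                                      (λ i k i<k → upper _ _ (s≤s i<k)) (λ i → diag (Fin.suc i))))
            (sumFin-zero n (λ j → signed-zero (suc (toℕ j)) (trans (*-congʳ (upper Fin.zero (Fin.suc j) (s≤s z≤n))) (zeroˡ _)))))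
    (trans (+-identityʳ _) (*-identityˡ _))

  det-lastColumn : ∀ n (M : Fin (suc n) → Fin (suc n) → Carrier) → (∀ i → M (inject₁ i) (fromℕ n) ≈ 0#) →
    det (suc n) M ≈ M (fromℕ n) (fromℕ n) * det n (λ i j → M (inject₁ i) (inject₁ j))
  det-lastColumn zero    M _         = +-identityʳ _
  det-lastColumn (suc n) M column≈0 = begin
    det (suc (suc n)) M
      ≈⟨ sumFin-last (suc n) term ⟩
    sumFin (suc n) (λ j → term (inject₁ j)) + term (fromℕ (suc n))
      ≈⟨ +-cong (sumFin-cong (suc n) expandMinor) (signed-zero (toℕ (fromℕ (suc n))) (trans (*-congʳ (column≈0 Fin.zero)) (zeroˡ _))) ⟩
    sumFin (suc n) (λ j → corner * signed (toℕ j) (M Fin.zero (inject₁ j) * minor j)) + 0#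
      ≈⟨ trans (+-identityʳ _) (sym (sumFin-*ˡ (suc n) corner (λ j → signed (toℕ j) (M Fin.zero (inject₁ j) * minor j)))) ⟩
    corner * det (suc n) (λ i j → M (inject₁ i) (inject₁ j)) ∎
    where
    corner = M (fromℕ (suc n)) (fromℕ (suc n))
    term minor : Fin _ → Carrier
    term j = signed (toℕ j) (M Fin.zero j * det (suc n) (λ i k → M (Fin.suc i) (punchIn j k)))
    minor j = det n (λ i k → M (inject₁ (Fin.suc i)) (inject₁ (punchIn j k)))
    expandMinor : ∀ j → term (inject₁ j) ≈ corner * signed (toℕ j) (M Fin.zero (inject₁ j) * minor j)
    expandMinor j = begin
      term (inject₁ j)
        ≈⟨ reflexive (≡.cong (λ t → signed t (M Fin.zero (inject₁ j) * det (suc n) N)) (Fin.toℕ-inject₁ j)) ⟩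
      signed (toℕ j) (M Fin.zero (inject₁ j) * det (suc n) N)
        ≈⟨ signed-cong (toℕ j) (*-congˡ (det-lastColumn n N (λ i →
             trans (reflexive (≡.cong (M (Fin.suc (inject₁ i))) (punchIn-inject₁-fromℕ j))) (column≈0 (Fin.suc i))))) ⟩
      signed (toℕ j) (M Fin.zero (inject₁ j) * (N (fromℕ n) (fromℕ n) * det n (λ i k → N (inject₁ i) (inject₁ k))))
        ≈⟨ signed-cong (toℕ j) (*-congˡ (*-cong (reflexive (≡.cong (M (fromℕ (suc n))) (punchIn-inject₁-fromℕ j)))
             (det-cong n (λ i k → reflexive (≡.cong (M (Fin.suc (inject₁ i))) (punchIn-inject₁ j k)))))) ⟩
      signed (toℕ j) (M Fin.zero (inject₁ j) * (corner * minor j))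
        ≈⟨ trans (signed≈sign* (toℕ j) _) (trans (solve 4 (λ s a b d → s :* (a :* (b :* d)) := b :* (s :* (a :* d))) refl _ _ _ _)
             (*-congˡ (sym (signed≈sign* (toℕ j) _)))) ⟩
      corner * signed (toℕ j) (M Fin.zero (inject₁ j) * minor j) ∎
      where
      N : Fin (suc n) → Fin (suc n) → Carrier
      N i k = M (Fin.suc i) (punchIn (inject₁ j) k)

module PowerSeries {c ℓ : Level} (R : CommutativeRing c ℓ) where
  open CommutativeRing R hiding (zero)
  open Factorial R
  open IntegerCoefficientSolver R using (solve; _:+_; _:*_; :-_; _:=_; con)
  open import Relation.Binary.Reasoning.Setoid setoid

  sumUpTo-cong : ∀ m {f g : ℕ → Carrier} → (∀ k → f k ≈ g k) → sumUpTo m f ≈ sumUpTo m g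
  sumUpTo-cong zero    f≈g = refl
  sumUpTo-cong (suc m) f≈g = +-cong (sumUpTo-cong m f≈g) (f≈g m)

  sumUpTo-first : ∀ m (f : ℕ → Carrier) → sumUpTo (suc m) f ≈ f 0 + sumUpTo m (λ k → f (suc k))
  sumUpTo-first zero    f = trans (+-identityˡ _) (sym (+-identityʳ _))
  sumUpTo-first (suc m) f = trans (+-congʳ (sumUpTo-first m f)) (+-assoc _ _ _)

  sumUpTo-zero : ∀ m {f : ℕ → Carrier} → (∀ k → f k ≈ 0#) → sumUpTo m f ≈ 0#
  sumUpTo-zero zero    f≈0 = refl
  sumUpTo-zero (suc m) f≈0 = trans (+-cong (sumUpTo-zero m f≈0) (f≈0 m)) (+-identityʳ 0#)

  sumUpTo-+ : ∀ m (f g : ℕ → Carrier) → sumUpTo m (λ k → f k + g k) ≈ sumUpTo m f + sumUpTo m g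
  sumUpTo-+ zero    f g = sym (+-identityʳ 0#)
  sumUpTo-+ (suc m) f g = trans (+-congʳ (sumUpTo-+ m f g))
    (solve 4 (λ a b d e → (a :+ b) :+ (d :+ e) := (a :+ d) :+ (b :+ e)) refl _ _ _ _)

  sumUpTo-*ˡ : ∀ m a (f : ℕ → Carrier) → a * sumUpTo m f ≈ sumUpTo m (λ k → a * f k)
  sumUpTo-*ˡ zero    a f = zeroʳ a
  sumUpTo-*ˡ (suc m) a f = trans (distribˡ _ _ _) (+-congʳ (sumUpTo-*ˡ m a f))

  infix 4 _≋_
  _≋_ : Series → Series → Set ℓ
  f ≋ g = ∀ k → f k ≈ g k

  negS : Series → Series
  negS f k = - f k

  shift : Series → Series
  shift f k = f (suc k)

  ⊛-coeff₀ : ∀ f g → (f ⊛ g) 0 ≈ f 0 * g 0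
  ⊛-coeff₀ f g = +-identityˡ _

  ⊛-coeff-suc : ∀ f g m → (f ⊛ g) (suc m) ≈ f 0 * g (suc m) + (shift f ⊛ g) m
  ⊛-coeff-suc f g m = sumUpTo-first (suc m) (λ k → f k * g (suc m ∸ k))

  ⊛-cong : ∀ {f f′ g g′} → f ≋ f′ → g ≋ g′ → (f ⊛ g) ≋ (f′ ⊛ g′)
  ⊛-cong f≋f′ g≋g′ m = sumUpTo-cong (suc m) (λ k → *-cong (f≋f′ k) (g≋g′ (m ∸ k)))

  ⊛-zeroˡ : ∀ f g → f ≋ zeroS → (f ⊛ g) ≋ zeroS
  ⊛-zeroˡ f g f≋0 m = sumUpTo-zero (suc m) (λ k → trans (*-congʳ (f≋0 k)) (zeroˡ _))

  ⊛-distribʳ : ∀ f g h → ((f ⊕ g) ⊛ h) ≋ ((f ⊛ h) ⊕ (g ⊛ h))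
  ⊛-distribʳ f g h m = trans (sumUpTo-cong (suc m) (λ k → distribʳ _ _ _)) (sumUpTo-+ (suc m) _ _)

  ⊛-*ˡ : ∀ a f g → ((λ k → a * f k) ⊛ g) ≋ (λ k → a * (f ⊛ g) k)
  ⊛-*ˡ a f g m = trans (sumUpTo-cong (suc m) (λ k → *-assoc _ _ _)) (sym (sumUpTo-*ˡ (suc m) a _))

  ⊛-identityˡ : ∀ f → (oneS ⊛ f) ≋ f
  ⊛-identityˡ f zero    = trans (⊛-coeff₀ oneS f) (*-identityˡ _)
  ⊛-identityˡ f (suc m) = trans (⊛-coeff-suc oneS f m)
    (trans (+-cong (*-identityˡ _) (⊛-zeroˡ (shift oneS) f (λ _ → refl) m)) (+-identityʳ _))

  ⊛-comm : ∀ f g → (f ⊛ g) ≋ (g ⊛ f)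
  ⊛-comm f g zero = trans (⊛-coeff₀ f g) (trans (*-comm _ _) (sym (⊛-coeff₀ g f)))
  ⊛-comm f g (suc zero) = begin
    (f ⊛ g) 1                      ≈⟨ ⊛-coeff-suc f g 0 ⟩
    f 0 * g 1 + (shift f ⊛ g) 0    ≈⟨ +-congˡ (⊛-coeff₀ (shift f) g) ⟩
    f 0 * g 1 + f 1 * g 0          ≈⟨ solve 4 (λ a b d e → a :* b :+ d :* e := e :* d :+ b :* a) refl _ _ _ _ ⟩
    g 0 * f 1 + g 1 * f 0          ≈⟨ +-congˡ (sym (⊛-coeff₀ (shift g) f)) ⟩
    g 0 * f 1 + (shift g ⊛ f) 0    ≈⟨ sym (⊛-coeff-suc g f 0) ⟩
    (g ⊛ f) 1                      ∎
  ⊛-comm f g (suc (suc m)) = begin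
    (f ⊛ g) (2+m)                                              ≈⟨ ⊛-coeff-suc f g (suc m) ⟩
    f 0 * g (2+m) + (shift f ⊛ g) (suc m)                      ≈⟨ +-congˡ (⊛-comm (shift f) g (suc m)) ⟩
    f 0 * g (2+m) + (g ⊛ shift f) (suc m)                      ≈⟨ +-congˡ (⊛-coeff-suc g (shift f) m) ⟩
    f 0 * g (2+m) + (g 0 * f (2+m) + (shift g ⊛ shift f) m)    ≈⟨ +-congˡ (+-congˡ (⊛-comm (shift g) (shift f) m)) ⟩
    f 0 * g (2+m) + (g 0 * f (2+m) + (shift f ⊛ shift g) m)
      ≈⟨ solve 5 (λ a b d e x → a :* b :+ (d :* e :+ x) := d :* e :+ (a :* b :+ x)) refl _ _ _ _ _ ⟩
    g 0 * f (2+m) + (f 0 * g (2+m) + (shift f ⊛ shift g) m)    ≈⟨ +-congˡ (sym (⊛-coeff-suc f (shift g) m)) ⟩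
    g 0 * f (2+m) + (f ⊛ shift g) (suc m)                      ≈⟨ +-congˡ (⊛-comm f (shift g) (suc m)) ⟩
    g 0 * f (2+m) + (shift g ⊛ f) (suc m)                      ≈⟨ sym (⊛-coeff-suc g f (suc m)) ⟩
    (g ⊛ f) (2+m)                                              ∎
    where 2+m = suc (suc m)

  ⊛-assoc : ∀ f g h → ((f ⊛ g) ⊛ h) ≋ (f ⊛ (g ⊛ h))
  ⊛-assoc f g h zero = begin
    ((f ⊛ g) ⊛ h) 0     ≈⟨ trans (⊛-coeff₀ (f ⊛ g) h) (*-congʳ (⊛-coeff₀ f g)) ⟩
    (f 0 * g 0) * h 0   ≈⟨ *-assoc _ _ _ ⟩
    f 0 * (g 0 * h 0)   ≈⟨ sym (trans (⊛-coeff₀ f (g ⊛ h)) (*-congˡ (⊛-coeff₀ g h))) ⟩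
    (f ⊛ (g ⊛ h)) 0     ∎
  ⊛-assoc f g h (suc m) = begin
    ((f ⊛ g) ⊛ h) (suc m)
      ≈⟨ ⊛-coeff-suc (f ⊛ g) h m ⟩
    (f ⊛ g) 0 * h (suc m) + (shift (f ⊛ g) ⊛ h) m
      ≈⟨ +-cong (*-congʳ (⊛-coeff₀ f g)) (⊛-cong {g = h} (⊛-coeff-suc f g) (λ k → refl) m) ⟩
    (f 0 * g 0) * h (suc m) + ((f0·shift-g ⊕ (shift f ⊛ g)) ⊛ h) m
      ≈⟨ +-congˡ (⊛-distribʳ f0·shift-g (shift f ⊛ g) h m) ⟩
    (f 0 * g 0) * h (suc m) + ((f0·shift-g ⊛ h) m + ((shift f ⊛ g) ⊛ h) m)
      ≈⟨ +-congˡ (+-cong (⊛-*ˡ (f 0) (shift g) h m) (⊛-assoc (shift f) g h m)) ⟩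
    (f 0 * g 0) * h (suc m) + (f 0 * (shift g ⊛ h) m + (shift f ⊛ (g ⊛ h)) m)
      ≈⟨ solve 5 (λ a b d e x → (a :* b) :* d :+ (a :* e :+ x) := a :* (b :* d :+ e) :+ x) refl _ _ _ _ _ ⟩
    f 0 * (g 0 * h (suc m) + (shift g ⊛ h) m) + (shift f ⊛ (g ⊛ h)) m
      ≈⟨ +-congʳ (*-congˡ (sym (⊛-coeff-suc g h m))) ⟩
    f 0 * (g ⊛ h) (suc m) + (shift f ⊛ (g ⊛ h)) m
      ≈⟨ sym (⊛-coeff-suc f (g ⊛ h) m) ⟩
    (f ⊛ (g ⊛ h)) (suc m) ∎
    where
    f0·shift-g : Series
    f0·shift-g k = f 0 * shift g k

  seriesRing : CommutativeRing c ℓ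
  seriesRing = record
    { Carrier = Series ; _≈_ = _≋_ ; _+_ = _⊕_ ; _*_ = _⊛_ ; -_ = negS ; 0# = zeroS ; 1# = oneS
    ; isCommutativeRing = record
      { isRing = record
        { +-isAbelianGroup = record
          { isGroup = record
            { isMonoid = record
              { isSemigroup = record
                { isMagma = record
                  { isEquivalence = record
                    { refl = λ _ → refl ; sym = λ f≋g k → sym (f≋g k) ; trans = λ f≋g g≋h k → trans (f≋g k) (g≋h k) }
                  ; ∙-cong = λ f≋f′ g≋g′ k → +-cong (f≋f′ k) (g≋g′ k) }
                ; assoc = λ _ _ _ _ → +-assoc _ _ _ }
              ; identity = (λ _ _ → +-identityˡ _) , (λ _ _ → +-identityʳ _) }
            ; inverse = (λ _ _ → -‿inverseˡ _) , (λ _ _ → -‿inverseʳ _)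
            ; ⁻¹-cong = λ f≋g k → -‿cong (f≋g k) }
          ; comm = λ _ _ _ → +-comm _ _ }
        ; *-cong = ⊛-cong
        ; *-assoc = ⊛-assoc
        ; *-identity = ⊛-identityˡ , (λ f k → trans (⊛-comm f oneS k) (⊛-identityˡ f k))
        ; distrib = (λ f g h k → trans (⊛-comm f (g ⊕ h) k) (trans (⊛-distribʳ g h f k) (+-cong (⊛-comm g f k) (⊛-comm h f k))))
                  , (λ f g h → ⊛-distribʳ g h f) }
      ; *-comm = ⊛-comm } }

  module SR = CommutativeRing seriesRing
  module SeriesSolver = IntegerCoefficientSolver seriesRing

  const : Carrier → Series
  const a zero    = a
  const a (suc _) = 0#

  t : Series
  t zero          = 0#
  t (suc zero)    = 1#
  t (suc (suc _)) = 0#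

  const-⊛ : ∀ a f k → (const a ⊛ f) k ≈ a * f k
  const-⊛ a f zero    = ⊛-coeff₀ (const a) f
  const-⊛ a f (suc k) = trans (⊛-coeff-suc (const a) f k)
    (trans (+-congˡ (⊛-zeroˡ (shift (const a)) f (λ _ → refl) k)) (+-identityʳ _))

  t-⊛₀ : ∀ f → (t ⊛ f) 0 ≈ 0#
  t-⊛₀ f = trans (⊛-coeff₀ t f) (zeroˡ _)

  t-⊛ : ∀ f k → (t ⊛ f) (suc k) ≈ f k
  t-⊛ f k = trans (⊛-coeff-suc t f k)
    (trans (+-cong (zeroˡ _) (trans (⊛-cong {g = f} shift-t≋1 (λ _ → refl) k) (const-⊛ 1# f k)))
    (trans (+-identityˡ _) (*-identityˡ _)))
    where
    shift-t≋1 : shift t ≋ const 1#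
    shift-t≋1 zero    = refl
    shift-t≋1 (suc _) = refl

  lin-⊛₀ : ∀ b f → (lin b ⊛ f) 0 ≈ f 0
  lin-⊛₀ b f = trans (⊛-coeff₀ (lin b) f) (*-identityˡ _)

  lin-⊛ : ∀ b f k → (lin b ⊛ f) (suc k) ≈ f (suc k) + b * f k
  lin-⊛ b f k = trans (⊛-coeff-suc (lin b) f k)
    (+-cong (*-identityˡ _) (trans (⊛-cong {g = f} shift-lin≋b (λ _ → refl) k) (const-⊛ b f k)))
    where
    shift-lin≋b : shift (lin b) ≋ const b
    shift-lin≋b zero    = refl
    shift-lin≋b (suc _) = refl

  geom-⊛ : ∀ y f k → (geom y ⊛ f) (suc k) ≈ y * (geom y ⊛ f) k + f (suc k)
  geom-⊛ y f k = trans (⊛-coeff-suc (geom y) f k) (trans (+-cong (*-identityˡ _)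
    (trans (⊛-cong {g = f} (λ j → *-comm (pow y j) y) (λ _ → refl) k) (⊛-*ˡ y (geom y) f k))) (+-comm _ _))

  lin-neg-⊛-geom : ∀ y → (lin (- y) ⊛ geom y) ≋ oneS
  lin-neg-⊛-geom y zero    = lin-⊛₀ (- y) (geom y)
  lin-neg-⊛-geom y (suc k) = trans (lin-⊛ (- y) (geom y) k)
    (solve 2 (λ p y → p :* y :+ (:- y) :* p := con (+ 0)) refl _ _)

  aProd-coeff₀ : ∀ a N → aProd a N 0 ≈ 1#
  aProd-coeff₀ a zero    = refl
  aProd-coeff₀ a (suc N) = trans (⊛-comm (aProd a N) (lin (a N)) 0)
    (trans (lin-⊛₀ (a N) (aProd a N)) (aProd-coeff₀ a N))

  aProd-coeff-high : ∀ a N k → N ℕ.< k → aProd a N k ≈ 0#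
  aProd-coeff-high a zero    (suc k) _         = refl
  aProd-coeff-high a (suc N) (suc k) (s≤s N<k) = trans (⊛-comm (aProd a N) (lin (a N)) (suc k))
    (trans (lin-⊛ (a N) (aProd a N) k)
    (trans (+-cong (aProd-coeff-high a N (suc k) (ℕ.m≤n⇒m≤1+n N<k))
                   (trans (*-congˡ (aProd-coeff-high a N k N<k)) (zeroʳ _)))
           (+-identityʳ 0#)))

  fpow≈coeff : ∀ y a e → fpow y a e ≈ (geom y ⊛ aProd a e) e
  fpow≈coeff y a zero    = sym (trans (⊛-coeff₀ (geom y) oneS) (*-identityˡ _))
  fpow≈coeff y a (suc e) = sym (begin
    (geom y ⊛ (aProd a e ⊛ lin (a e))) (suc e)   ≈⟨ sym (⊛-assoc (geom y) (aProd a e) (lin (a e)) (suc e)) ⟩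
    ((geom y ⊛ aProd a e) ⊛ lin (a e)) (suc e)   ≈⟨ ⊛-comm (geom y ⊛ aProd a e) (lin (a e)) (suc e) ⟩
    (lin (a e) ⊛ (geom y ⊛ aProd a e)) (suc e)   ≈⟨ lin-⊛ (a e) (geom y ⊛ aProd a e) e ⟩
    (geom y ⊛ aProd a e) (suc e) + a e * F       ≈⟨ +-congʳ (geom-⊛ y (aProd a e) e) ⟩
    (y * F + aProd a e (suc e)) + a e * F        ≈⟨ +-congʳ (+-congˡ (aProd-coeff-high a e (suc e) ℕ.≤-refl)) ⟩
    (y * F + 0#) + a e * F                       ≈⟨ +-cong (+-congʳ (*-congˡ (sym (fpow≈coeff y a e)))) (*-congˡ (sym (fpow≈coeff y a e))) ⟩
    (y * fpow y a e + 0#) + a e * fpow y a e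
      ≈⟨ solve 3 (λ y f b → (y :* f :+ con (+ 0)) :+ b :* f := f :* (y :+ b)) refl _ _ _ ⟩
    fpow y a e * (y + a e)                       ∎)
    where
    F = (geom y ⊛ aProd a e) e


module GeneratingFunctions {c ℓ : Level} (R : CommutativeRing c ℓ) where
  open CommutativeRing R hiding (zero)
  open Factorial R
  open PowerSeries R
  open IntegerCoefficientSolver R using (solve; _:+_; _:*_; :-_; _:=_; con)
  open SeriesSolver using () renaming (solve to solve⊛; _:+_ to _⊞_; _:*_ to _⊠_; :-_ to ⊟_; _:=_ to _⊜_)
  open import Relation.Binary.Reasoning.Setoid SR.setoid

  geom-⊛-lin-neg : ∀ y → (geom y ⊛ lin (- y)) ≋ oneS
  geom-⊛-lin-neg y = SR.trans (⊛-comm (geom y) (lin (- y))) (lin-neg-⊛-geom y)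

  linPair : Carrier × Carrier → Series
  linPair (y , ȳ) = lin (- y) ⊛ lin (- ȳ)

  geom²-⊛-linPair : ∀ p → (geom² p ⊛ linPair p) ≋ oneS
  geom²-⊛-linPair (y , ȳ) = begin
    (geom y ⊛ geom ȳ) ⊛ (lin (- y) ⊛ lin (- ȳ))
      ≈⟨ solve⊛ 4 (λ a b d e → (a ⊠ b) ⊠ (d ⊠ e) ⊜ (a ⊠ d) ⊠ (b ⊠ e)) SR.refl (geom y) (geom ȳ) (lin (- y)) (lin (- ȳ)) ⟩
    (geom y ⊛ lin (- y)) ⊛ (geom ȳ ⊛ lin (- ȳ)) ≈⟨ SR.*-cong (geom-⊛-lin-neg y) (geom-⊛-lin-neg ȳ) ⟩
    oneS ⊛ oneS                                 ≈⟨ SR.*-identityˡ oneS ⟩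
    oneS                                        ∎

  ⊛-inverse-sum : ∀ C D A A′ B B′ → (A ⊛ A′) ≋ oneS → (B ⊛ B′) ≋ oneS →
    ((C ⊛ A) ⊕ (D ⊛ B)) ≋ (((C ⊛ B′) ⊕ (D ⊛ A′)) ⊛ (A ⊛ B))
  ⊛-inverse-sum C D A A′ B B′ AA′≋1 BB′≋1 = begin
    (C ⊛ A) ⊕ (D ⊛ B)
      ≈⟨ SR.+-cong (SR.sym (SR.trans (SR.*-congˡ BB′≋1) (SR.*-identityʳ _)))
                   (SR.sym (SR.trans (SR.*-congˡ AA′≋1) (SR.*-identityʳ _))) ⟩
    ((C ⊛ A) ⊛ (B ⊛ B′)) ⊕ ((D ⊛ B) ⊛ (A ⊛ A′))
      ≈⟨ solve⊛ 6 (λ c d a a′ b b′ → (c ⊠ a) ⊠ (b ⊠ b′) ⊞ (d ⊠ b) ⊠ (a ⊠ a′)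
                                      ⊜ (c ⊠ b′ ⊞ d ⊠ a′) ⊠ (a ⊠ b)) SR.refl C D A A′ B B′ ⟩
    ((C ⊛ B′) ⊕ (D ⊛ A′)) ⊛ (A ⊛ B) ∎

  ⊛-inverse-difference : ∀ C D A A′ B B′ → (A ⊛ A′) ≋ oneS → (B ⊛ B′) ≋ oneS →
    ((C ⊛ A) ⊕ negS (D ⊛ B)) ≋ (((C ⊛ B′) ⊕ negS (D ⊛ A′)) ⊛ (A ⊛ B))
  ⊛-inverse-difference C D A A′ B B′ AA′≋1 BB′≋1 = begin
    (C ⊛ A) ⊕ negS (D ⊛ B)
      ≈⟨ SR.+-cong (SR.sym (SR.trans (SR.*-congˡ BB′≋1) (SR.*-identityʳ _)))
                   (SR.-‿cong (SR.sym (SR.trans (SR.*-congˡ AA′≋1) (SR.*-identityʳ _)))) ⟩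
    ((C ⊛ A) ⊛ (B ⊛ B′)) ⊕ negS ((D ⊛ B) ⊛ (A ⊛ A′))
      ≈⟨ solve⊛ 6 (λ c d a a′ b b′ → (c ⊠ a) ⊠ (b ⊠ b′) ⊞ ⊟ ((d ⊠ b) ⊠ (a ⊠ a′))
                                      ⊜ (c ⊠ b′ ⊞ ⊟ (d ⊠ a′)) ⊠ (a ⊠ b)) SR.refl C D A A′ B B′ ⟩
    ((C ⊛ B′) ⊕ negS (D ⊛ A′)) ⊛ (A ⊛ B) ∎

  lin-difference : ∀ y s → (lin (- s) ⊕ negS (lin (- y))) ≋ (const (y - s) ⊛ t)
  lin-difference y s zero = trans (-‿inverseʳ 1#) (sym (trans (const-⊛ (y - s) t 0) (zeroʳ _)))
  lin-difference y s (suc zero) = trans (solve 2 (λ s y → :- s :+ :- (:- y) := (y :+ :- s) :* con (+ 1)) refl s y)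
    (sym (const-⊛ (y - s) t 1))
  lin-difference y s (suc (suc k)) = trans (-‿inverseʳ 0#) (sym (trans (const-⊛ (y - s) t (suc (suc k))) (zeroʳ _)))

  geom-difference : ∀ y s → (geom y ⊕ negS (geom s)) ≋ ((const (y - s) ⊛ t) ⊛ (geom y ⊛ geom s))
  geom-difference y s = begin
    geom y ⊕ negS (geom s)
      ≈⟨ SR.sym (SR.+-cong (SR.*-identityˡ (geom y)) (SR.-‿cong (SR.*-identityˡ (geom s)))) ⟩
    (oneS ⊛ geom y) ⊕ negS (oneS ⊛ geom s)
      ≈⟨ ⊛-inverse-difference oneS oneS (geom y) (lin (- y)) (geom s) (lin (- s)) (geom-⊛-lin-neg y) (geom-⊛-lin-neg s) ⟩
    ((oneS ⊛ lin (- s)) ⊕ negS (oneS ⊛ lin (- y))) ⊛ (geom y ⊛ geom s)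
      ≈⟨ SR.*-congʳ {geom y ⊛ geom s}
           (SR.trans (SR.+-cong (SR.*-identityˡ (lin (- s))) (SR.-‿cong (SR.*-identityˡ (lin (- y))))) (lin-difference y s)) ⟩
    (const (y - s) ⊛ t) ⊛ (geom y ⊛ geom s) ∎

  pairSum : Carrier × Carrier → Carrier
  pairSum (y , ȳ) = y + ȳ

  IsInversePair : Carrier × Carrier → Set ℓ
  IsInversePair (y , ȳ) = y * ȳ ≈ 1#

  linPair-difference : ∀ p q → IsInversePair p → IsInversePair q →
    (linPair q ⊕ negS (linPair p)) ≋ (const (pairSum p - pairSum q) ⊛ t)
  linPair-difference (y , ȳ) (s , s̄) yȳ≈1 ss̄≈1 k = trans (coefficient k) (sym (const-⊛ d t k))
    where
    d = (y + ȳ) - (s + s̄)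
    coefficient : ∀ k → (linPair (s , s̄) ⊕ negS (linPair (y , ȳ))) k ≈ d * t k
    coefficient zero = trans (+-cong (lin-⊛₀ (- s) (lin (- s̄))) (-‿cong (lin-⊛₀ (- y) (lin (- ȳ)))))
      (trans (-‿inverseʳ 1#) (sym (zeroʳ d)))
    coefficient (suc zero) = trans (+-cong (lin-⊛ (- s) (lin (- s̄)) 0) (-‿cong (lin-⊛ (- y) (lin (- ȳ)) 0)))
      (solve 4 (λ s s̄ y ȳ → (:- s̄ :+ (:- s) :* con (+ 1)) :+ :- (:- ȳ :+ (:- y) :* con (+ 1))
                            := ((y :+ ȳ) :+ :- (s :+ s̄)) :* con (+ 1)) refl s s̄ y ȳ)
    coefficient (suc (suc zero)) = trans (+-cong (lin-⊛ (- s) (lin (- s̄)) 1) (-‿cong (lin-⊛ (- y) (lin (- ȳ)) 1)))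
      (trans (+-cong (+-congˡ (neg-*-neg≈1 ss̄≈1)) (-‿cong (+-congˡ (neg-*-neg≈1 yȳ≈1))))
      (trans (solve 1 (λ o → (con (+ 0) :+ o) :+ :- (con (+ 0) :+ o) := con (+ 0)) refl 1#) (sym (zeroʳ d))))
      where
      neg-*-neg≈1 : ∀ {a b} → a * b ≈ 1# → - a * - b ≈ 1#
      neg-*-neg≈1 {a} {b} ab≈1 = trans (solve 2 (λ a b → (:- a) :* (:- b) := a :* b) refl a b) ab≈1
    coefficient (suc (suc (suc k))) = trans (+-cong (lin-⊛ (- s) (lin (- s̄)) (suc (suc k))) (-‿cong (lin-⊛ (- y) (lin (- ȳ)) (suc (suc k)))))
      (trans (solve 2 (λ a b → (con (+ 0) :+ a :* con (+ 0)) :+ :- (con (+ 0) :+ b :* con (+ 0)) := con (+ 0)) refl (- s) (- y))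
      (sym (zeroʳ d)))

  geom²-difference : ∀ p q → IsInversePair p → IsInversePair q →
    (geom² p ⊕ negS (geom² q)) ≋ ((const (pairSum p - pairSum q) ⊛ t) ⊛ (geom² p ⊛ geom² q))
  geom²-difference p q p⁻¹ q⁻¹ = begin
    geom² p ⊕ negS (geom² q)
      ≈⟨ SR.sym (SR.+-cong (SR.*-identityˡ (geom² p)) (SR.-‿cong (SR.*-identityˡ (geom² q)))) ⟩
    (oneS ⊛ geom² p) ⊕ negS (oneS ⊛ geom² q)
      ≈⟨ ⊛-inverse-difference oneS oneS (geom² p) (linPair p) (geom² q) (linPair q) (geom²-⊛-linPair p) (geom²-⊛-linPair q) ⟩
    ((oneS ⊛ linPair q) ⊕ negS (oneS ⊛ linPair p)) ⊛ (geom² p ⊛ geom² q)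
      ≈⟨ SR.*-congʳ {geom² p ⊛ geom² q} (SR.trans (SR.+-cong (SR.*-identityˡ (linPair q)) (SR.-‿cong (SR.*-identityˡ (linPair p))))
                              (linPair-difference p q p⁻¹ q⁻¹)) ⟩
    (const (pairSum p - pairSum q) ⊛ t) ⊛ (geom² p ⊛ geom² q) ∎

  scaled-geom-difference : ∀ y ȳ → (const (y - ȳ) ⊛ geom² (y , ȳ)) ≋ ((const y ⊛ geom y) ⊕ negS (const ȳ ⊛ geom ȳ))
  scaled-geom-difference y ȳ = SR.sym (SR.trans
    (⊛-inverse-difference (const y) (const ȳ) (geom y) (lin (- y)) (geom ȳ) (lin (- ȳ)) (geom-⊛-lin-neg y) (geom-⊛-lin-neg ȳ))
    (SR.*-congʳ {geom² (y , ȳ)} coefficients))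
    where
    coefficients : ((const y ⊛ lin (- ȳ)) ⊕ negS (const ȳ ⊛ lin (- y))) ≋ const (y - ȳ)
    coefficients k = trans (+-cong (const-⊛ y (lin (- ȳ)) k) (-‿cong (const-⊛ ȳ (lin (- y)) k))) (coefficient k)
      where
      coefficient : ∀ k → y * lin (- ȳ) k - ȳ * lin (- y) k ≈ const (y - ȳ) k
      coefficient zero          = solve 2 (λ y b → y :* con (+ 1) :+ :- (b :* con (+ 1)) := y :+ :- b) refl y ȳ
      coefficient (suc zero)    = solve 2 (λ y b → y :* (:- b) :+ :- (b :* (:- y)) := con (+ 0)) refl y ȳ
      coefficient (suc (suc _)) = solve 2 (λ y b → y :* con (+ 0) :+ :- (b :* con (+ 0)) := con (+ 0)) refl y ȳ

  scaled-geom-difference-squares : ∀ z z̄ → z * z̄ ≈ 1# →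
    (const (z - z̄) ⊛ (lin 1# ⊛ geom² (z * z , z̄ * z̄))) ≋ ((const z ⊛ geom (z * z)) ⊕ negS (const z̄ ⊛ geom (z̄ * z̄)))
  scaled-geom-difference-squares z z̄ zz̄≈1 = SR.sym (begin
    (const z ⊛ geom x) ⊕ negS (const z̄ ⊛ geom x̄)
      ≈⟨ ⊛-inverse-difference (const z) (const z̄) (geom x) (lin (- x)) (geom x̄) (lin (- x̄)) (geom-⊛-lin-neg x) (geom-⊛-lin-neg x̄) ⟩
    ((const z ⊛ lin (- x̄)) ⊕ negS (const z̄ ⊛ lin (- x))) ⊛ geom² (x , x̄)
      ≈⟨ SR.*-congʳ {geom² (x , x̄)} coefficients ⟩
    (const (z - z̄) ⊛ lin 1#) ⊛ geom² (x , x̄)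
      ≈⟨ SR.*-assoc (const (z - z̄)) (lin 1#) (geom² (x , x̄)) ⟩
    const (z - z̄) ⊛ (lin 1# ⊛ geom² (x , x̄)) ∎)
    where
    x = z * z
    x̄ = z̄ * z̄
    coefficients : ((const z ⊛ lin (- x̄)) ⊕ negS (const z̄ ⊛ lin (- x))) ≋ (const (z - z̄) ⊛ lin 1#)
    coefficients k = trans (+-cong (const-⊛ z (lin (- x̄)) k) (-‿cong (const-⊛ z̄ (lin (- x)) k)))
                           (trans (coefficient k) (sym (const-⊛ (z - z̄) (lin 1#) k)))
      where
      coefficient : ∀ k → z * lin (- x̄) k - z̄ * lin (- x) k ≈ (z - z̄) * lin 1# k
      coefficient zero = solve 2 (λ y b → y :* con (+ 1) :+ :- (b :* con (+ 1)) := (y :+ :- b) :* con (+ 1)) refl z z̄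
      coefficient (suc zero) = trans
        (solve 2 (λ y b → y :* (:- (b :* b)) :+ :- (b :* (:- (y :* y))) := (y :* b) :* (y :+ :- b)) refl z z̄)
        (trans (*-congʳ zz̄≈1) (*-comm 1# (z - z̄)))
      coefficient (suc (suc _)) = solve 2 (λ y b → y :* con (+ 0) :+ :- (b :* con (+ 0)) := (y :+ :- b) :* con (+ 0)) refl z z̄

  geom-sum : ∀ y ȳ → y * ȳ ≈ 1# → (geom y ⊕ geom ȳ) ≋ ((oneMinusT² ⊛ geom² (y , ȳ)) ⊕ oneS)
  geom-sum y ȳ yȳ≈1 = begin
    geom y ⊕ geom ȳ
      ≈⟨ SR.sym (SR.+-cong (SR.*-identityˡ (geom y)) (SR.*-identityˡ (geom ȳ))) ⟩
    (oneS ⊛ geom y) ⊕ (oneS ⊛ geom ȳ)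
      ≈⟨ ⊛-inverse-sum oneS oneS (geom y) (lin (- y)) (geom ȳ) (lin (- ȳ)) (geom-⊛-lin-neg y) (geom-⊛-lin-neg ȳ) ⟩
    ((oneS ⊛ lin (- ȳ)) ⊕ (oneS ⊛ lin (- y))) ⊛ geom² (y , ȳ)
      ≈⟨ SR.*-congʳ {geom² (y , ȳ)} (SR.trans (SR.+-cong (SR.*-identityˡ (lin (- ȳ))) (SR.*-identityˡ (lin (- y)))) coefficients) ⟩
    (oneMinusT² ⊕ linPair (y , ȳ)) ⊛ geom² (y , ȳ)
      ≈⟨ solve⊛ 3 (λ d l a → (d ⊞ l) ⊠ a ⊜ d ⊠ a ⊞ a ⊠ l) SR.refl oneMinusT² (linPair (y , ȳ)) (geom² (y , ȳ)) ⟩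
    (oneMinusT² ⊛ geom² (y , ȳ)) ⊕ (geom² (y , ȳ) ⊛ linPair (y , ȳ))
      ≈⟨ SR.+-congˡ (geom²-⊛-linPair (y , ȳ)) ⟩
    (oneMinusT² ⊛ geom² (y , ȳ)) ⊕ oneS ∎
    where
    coefficients : (lin (- ȳ) ⊕ lin (- y)) ≋ (oneMinusT² ⊕ linPair (y , ȳ))
    coefficients zero = +-congˡ (sym (lin-⊛₀ (- y) (lin (- ȳ))))
    coefficients (suc zero) = trans (solve 2 (λ y b → :- b :+ :- y := con (+ 0) :+ (:- b :+ (:- y) :* con (+ 1))) refl y ȳ)
      (+-congˡ (sym (lin-⊛ (- y) (lin (- ȳ)) 0)))
    coefficients (suc (suc zero)) = sym (trans (+-congˡ (lin-⊛ (- y) (lin (- ȳ)) 1))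
      (trans (solve 2 (λ y b → :- con (+ 1) :+ (con (+ 0) :+ (:- y) :* (:- b)) := y :* b :+ :- con (+ 1)) refl y ȳ)
      (trans (+-congʳ yȳ≈1) (trans (-‿inverseʳ 1#) (sym (+-identityʳ 0#))))))
    coefficients (suc (suc (suc k))) = trans (solve 1 (λ y → con (+ 0) :+ con (+ 0) := con (+ 0) :+ (con (+ 0) :+ y :* con (+ 0))) refl (- y))
      (+-congˡ (sym (lin-⊛ (- y) (lin (- ȳ)) (suc (suc k)))))

module ProductFamilies {c ℓ : Level} (R : CommutativeRing c ℓ) where
  open CommutativeRing R hiding (zero)
  open Factorial R
  open PowerSeries R
  open SeriesSolver using () renaming (solve to solve⊛; _:+_ to _⊞_; _:*_ to _⊠_; :-_ to ⊟_; _:=_ to _⊜_)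
  open import Relation.Binary.Reasoning.Setoid setoid

  module _ (d : Carrier) (U V W : Series) (U-V : (U ⊕ negS V) ≋ ((const d ⊛ t) ⊛ W)) where

    ⊛-recurrence : ∀ P → (U ⊛ P) ≋ ((V ⊛ P) ⊕ (t ⊛ (const d ⊛ (W ⊛ P))))
    ⊛-recurrence P = SR.trans (solve⊛ 3 (λ u v p → u ⊠ p ⊜ v ⊠ p ⊞ (u ⊞ ⊟ v) ⊠ p) SR.refl U V P)
      (SR.trans (SR.+-congˡ (SR.*-congʳ {P} U-V))
      (SR.+-congˡ (solve⊛ 4 (λ d′ t′ w p → ((d′ ⊠ t′) ⊠ w) ⊠ p ⊜ t′ ⊠ (d′ ⊠ (w ⊠ p))) SR.refl (const d) t W P)))

    ⊛-recurrence-suc : ∀ P m → (U ⊛ P) (suc m) ≈ (V ⊛ P) (suc m) + d * (W ⊛ P) m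
    ⊛-recurrence-suc P m = trans (⊛-recurrence P (suc m)) (+-congˡ (trans (t-⊛ (const d ⊛ (W ⊛ P)) m) (const-⊛ d (W ⊛ P) m)))

    ⊛-recurrence-zero : ∀ P → (U ⊛ P) 0 ≈ (V ⊛ P) 0
    ⊛-recurrence-zero P = trans (⊛-recurrence P 0) (trans (+-congˡ (t-⊛₀ (const d ⊛ (W ⊛ P)))) (+-identityʳ _))

  module ProductFamily (a : ℕ → Carrier) {V : Set c} (Q : Series) (g : V → Series) where

    gProduct : List V → Series
    gProduct S = prodList (List.map g S)

    generating : List V → Series
    generating S = Q ⊛ gProduct S

    family : List V → ℤ → Carrier
    family S (+ m)    = (generating S ⊛ aProd a (length S ℕ.+ m ∸ 1)) m
    family S -[1+ _ ] = 0#

    module _ (y s : V) (d : Carrier) (gy-gs : (g y ⊕ negS (g s)) ≋ ((const d ⊛ t) ⊛ (g y ⊛ g s))) where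

      generating-difference : ∀ T → (generating (y ∷ T) ⊕ negS (generating (s ∷ T))) ≋ ((const d ⊛ t) ⊛ generating (y ∷ s ∷ T))
      generating-difference T = SR.trans
        (solve⊛ 4 (λ q gy gs p → q ⊠ (gy ⊠ p) ⊞ ⊟ (q ⊠ (gs ⊠ p)) ⊜ (gy ⊞ ⊟ gs) ⊠ (q ⊠ p)) SR.refl Q (g y) (g s) (gProduct T))
        (SR.trans (SR.*-congʳ {generating T} gy-gs)
        (solve⊛ 6 (λ gy gs d′ t′ q p → ((d′ ⊠ t′) ⊠ (gy ⊠ gs)) ⊠ (q ⊠ p) ⊜ (d′ ⊠ t′) ⊠ (q ⊠ (gy ⊠ (gs ⊠ p))))
                   SR.refl (g y) (g s) (const d) t Q (gProduct T)))

      family-recurrence : ∀ T b → family (y ∷ T) (ℤ.suc b) ≈ family (s ∷ T) (ℤ.suc b) + d * family (y ∷ s ∷ T) b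
      family-recurrence T (+ m) = begin
        (generating (y ∷ T) ⊛ P) (suc m)
          ≈⟨ ⊛-recurrence-suc d _ _ (generating (y ∷ s ∷ T)) (generating-difference T) P m ⟩
        (generating (s ∷ T) ⊛ P) (suc m) + d * (generating (y ∷ s ∷ T) ⊛ P) m
          ≈⟨ +-congˡ (*-congˡ (reflexive (≡.cong (λ K → (generating (y ∷ s ∷ T) ⊛ aProd a K) m) (ℕ.+-suc (length T) m)))) ⟩
        (generating (s ∷ T) ⊛ P) (suc m) + d * family (y ∷ s ∷ T) (+ m) ∎
        where P = aProd a (length T ℕ.+ suc m)
      family-recurrence T -[1+ zero ] = trans
        (⊛-recurrence-zero d _ _ (generating (y ∷ s ∷ T)) (generating-difference T) (aProd a (length T ℕ.+ 0)))
        (trans (sym (+-identityʳ _)) (+-congˡ (sym (zeroʳ d))))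
      family-recurrence T -[1+ suc _ ] = trans (sym (+-identityʳ 0#)) (+-congˡ (sym (zeroʳ d)))

    family-zero : Q 0 ≈ 1# → (∀ v → g v 0 ≈ 1#) → ∀ S → family S (+ 0) ≈ 1#
    family-zero Q₀≈1 g₀≈1 S = trans (⊛-coeff₀ (Q ⊛ gProduct S) (aProd a (length S ℕ.+ 0 ∸ 1)))
      (trans (*-cong (trans (⊛-coeff₀ Q (gProduct S)) (*-cong Q₀≈1 (gProduct₀ S))) (aProd-coeff₀ a (length S ℕ.+ 0 ∸ 1)))
      (trans (*-identityʳ _) (*-identityˡ 1#)))
      where
      gProduct₀ : ∀ S → gProduct S 0 ≈ 1#
      gProduct₀ []      = refl
      gProduct₀ (v ∷ S) = trans (⊛-coeff₀ (g v) (gProduct S)) (trans (*-cong (g₀≈1 v) (gProduct₀ S)) (*-identityˡ 1#))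

    family-single : ∀ v e → family (v ∷ []) (+ e) ≈ ((Q ⊛ g v) ⊛ aProd a e) e
    family-single v e = ⊛-cong {g = aProd a e} (SR.*-congˡ {Q} (SR.*-identityʳ (g v))) (λ _ → refl) e

module DividedDifferences {c ℓ : Level} (R : CommutativeRing c ℓ) where
  open CommutativeRing R hiding (zero)
  open Factorial R
  open Determinants R
  open IntegerCoefficientSolver R using (solve; _:+_; _:*_; _:=_)
  open import Relation.Binary.Reasoning.Setoid setoid

  partitionIndex : ∀ {N} → (Fin N → ℕ) → Fin N → ℤ
  partitionIndex lam j = + lam j ℤ.- + toℕ j

  exponent≡index : ∀ L j N → j ℕ.< N → + N ℤ.+ ℤ.pred (+ L ℤ.- + j) ≡ + (L ℕ.+ (N ∸ suc j))
  exponent≡index L j N j<N with ℕ.m≤n⇒∃[o]m+o≡n j<N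
  ... | r , ≡.refl =
    ≡.trans (≡.cong (λ i → i ℤ.+ ℤ.pred (+ L ℤ.- + j)) (ℤ.pos-+ (suc j) r))
    (≡.trans (exponent-identity (+ L) (+ j) (+ r))
    (≡.trans (≡.sym (ℤ.pos-+ L r))
             (≡.cong (λ m → + (L ℕ.+ m)) (≡.sym (ℕ.m+n∸m≡n (suc j) r)))))

  partitionExponent≡index : ∀ N (lam : Fin N → ℕ) j → + N ℤ.+ ℤ.pred (partitionIndex lam j) ≡ + ex N lam j
  partitionExponent≡index N lam j = exponent≡index (lam j) (toℕ j) N (Fin.toℕ<n j)

  negativeIndex : ∀ j k → k ℕ.< j → ∃ λ m → (ℤ.0ℤ ℤ.- + j) ℤ.+ + k ≡ -[1+ m ]
  negativeIndex j k k<j with ℕ.m≤n⇒∃[o]m+o≡n k<j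
  ... | r , ≡.refl = r , ≡.trans
    (≡.cong (λ i → (ℤ.0ℤ ℤ.- i) ℤ.+ + k) (≡.trans (ℤ.pos-+ (suc k) r) (≡.cong (ℤ._+ + r) (ℤ.pos-+ 1 k))))
    (below-identity (+ r) (+ k))

  diagonalIndex : ∀ j → (ℤ.0ℤ ℤ.- + j) ℤ.+ + j ≡ ℤ.0ℤ
  diagonalIndex j = diagonal-identity (+ j)

  det-zeroPartition : ∀ {v} {V : Set v} (h : List V → ℤ → Carrier) → (∀ S m → h S -[1+ m ] ≈ 0#) → (∀ S → h S (+ 0) ≈ 1#) →
    ∀ N (rows : Fin N → List V) lam → det N (λ k j → h (rows k) (idx (zero-part lam) k j)) ≈ 1#
  det-zeroPartition h h-negative h-zero N rows lam = det-lowerUnitriangular N _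
    (λ k j k<j → trans (reflexive (≡.cong (h (rows k)) (proj₂ (negativeIndex (toℕ j) (toℕ k) k<j)))) (h-negative _ _))
    (λ k → trans (reflexive (≡.cong (h (rows k)) (diagonalIndex (toℕ k)))) (h-zero _))

  module _ {v} {V : Set v} (h : List V → ℤ → Carrier) (δ : V → V → Carrier)
           (h-recurrence : ∀ y s T b → h (y ∷ T) (ℤ.suc b) ≈ h (s ∷ T) (ℤ.suc b) + δ y s * h (y ∷ s ∷ T) b) where

    δProduct : V → List V → Carrier
    δProduct y []      = 1#
    δProduct y (s ∷ S) = δ y s * δProduct y S

    newtonSum : V → List V → List V → ℤ → Carrier
    newtonSum y []      T b = 0#
    newtonSum y (s ∷ S) T b = δProduct y S * h (s ∷ S ++ T) b + newtonSum y S T (ℤ.suc b)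

    h-newton : ∀ y S T b → h (y ∷ T) (+ length S ℤ.+ b) ≈ newtonSum y S T (ℤ.suc b) + δProduct y S * h (y ∷ S ++ T) b
    h-newton y [] T b = trans (reflexive (≡.cong (h (y ∷ T)) (ℤ.+-identityˡ b))) (sym (trans (+-identityˡ _) (*-identityˡ _)))
    h-newton y (s ∷ S) T b = begin
      h (y ∷ T) (+ suc (length S) ℤ.+ b)  ≈⟨ reflexive (≡.cong (h (y ∷ T)) (suc-+-assoc (+ length S) b)) ⟩
      h (y ∷ T) (+ length S ℤ.+ ℤ.suc b)  ≈⟨ h-newton y S T (ℤ.suc b) ⟩
      newtonSum y S T (ℤ.suc (ℤ.suc b)) + δProduct y S * h (y ∷ S ++ T) (ℤ.suc b)
        ≈⟨ +-congˡ (*-congˡ (h-recurrence y s (S ++ T) b)) ⟩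
      newtonSum y S T (ℤ.suc (ℤ.suc b)) + δProduct y S * (h (s ∷ S ++ T) (ℤ.suc b) + δ y s * h (y ∷ s ∷ S ++ T) b)
        ≈⟨ solve 5 (λ n p a d b → n :+ p :* (a :+ d :* b) := (p :* a :+ n) :+ (d :* p) :* b) refl _ _ _ _ _ ⟩
      newtonSum y (s ∷ S) T (ℤ.suc b) + δProduct y (s ∷ S) * h (y ∷ s ∷ S ++ T) b ∎

    δProduct-drop : ∀ y N (xs : Fin N → V) d (i : Fin N) → d ℕ.≤ toℕ i → δ y (xs i) ≈ 0# →
      δProduct y (drop d (List.tabulate xs)) ≈ 0#
    δProduct-drop y (suc N) xs zero    Fin.zero    z≤n       δ≈0 = trans (*-congʳ δ≈0) (zeroˡ _)
    δProduct-drop y (suc N) xs zero    (Fin.suc i) z≤n       δ≈0 =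
      trans (*-congˡ (δProduct-drop y N (λ k → xs (Fin.suc k)) zero i z≤n δ≈0)) (zeroʳ _)
    δProduct-drop y (suc N) xs (suc d) (Fin.suc i) (s≤s d≤i) δ≈0 = δProduct-drop y N (λ k → xs (Fin.suc k)) d i d≤i δ≈0

    newtonSum-tabulate : ∀ y N (xs : Fin N → V) b → newtonSum y (List.tabulate xs) [] b ≈
      sumFin N (λ k → δProduct y (drop (suc (toℕ k)) (List.tabulate xs)) * h (drop (toℕ k) (List.tabulate xs)) (b ℤ.+ + toℕ k))
    newtonSum-tabulate y zero    xs b = refl
    newtonSum-tabulate y (suc N) xs b = +-cong
      (*-congˡ (trans (reflexive (≡.cong (λ L → h (xs Fin.zero ∷ L) b) (List.++-identityʳ _)))
                      (reflexive (≡.cong (h _) (≡.sym (ℤ.+-identityʳ b))))))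
      (trans (newtonSum-tabulate y N (λ k → xs (Fin.suc k)) (ℤ.suc b))
             (sumFin-cong N (λ k → *-congˡ (reflexive (≡.cong (h _) (suc-+-assoc b (+ toℕ k)))))))

    module _ (N : ℕ) (xs : Fin N → V) (δ-refl : ∀ y → δ y y ≈ 0#) where

      newtonMatrix : (Fin N → Carrier) → Fin N → Fin N → Carrier
      newtonMatrix r i k = r i * δProduct (xs i) (drop (suc (toℕ k)) (List.tabulate xs))

      shiftedMatrix : (Fin N → ℤ) → Fin N → Fin N → Carrier
      shiftedMatrix b k j = h (drop (toℕ k) (List.tabulate xs)) (b j ℤ.+ + toℕ k)

      newtonMatrix-upperTriangular : ∀ r → UpperTriangular N (newtonMatrix r)
      newtonMatrix-upperTriangular r i k k<i =
        trans (*-congˡ (δProduct-drop (xs i) N xs (suc (toℕ k)) i k<i (δ-refl (xs i)))) (zeroʳ _)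

      -- Newton's formula with T = [] and S = (x_1, ..., x_N); its last term contains δ(x_i, x_i) = 0.
      entry≈matMul : ∀ r (b : Fin N → ℤ) (e : Fin N → ℕ) → (∀ j → + N ℤ.+ ℤ.pred (b j) ≡ + e j) → ∀ i j →
        r i * h (xs i ∷ []) (+ e j) ≈ matMul N (newtonMatrix r) (shiftedMatrix b) i j
      entry≈matMul r b e b≈e i j = begin
        r i * h (x ∷ []) (+ e j)
          ≈⟨ *-congˡ (reflexive (≡.cong (h (x ∷ []))
               (≡.sym (≡.trans (≡.cong (λ n → + n ℤ.+ ℤ.pred (b j)) (List.length-tabulate xs)) (b≈e j))))) ⟩
        r i * h (x ∷ []) (+ length tab ℤ.+ ℤ.pred (b j))
          ≈⟨ *-congˡ (h-newton x tab [] (ℤ.pred (b j))) ⟩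
        r i * (newtonSum x tab [] (ℤ.suc (ℤ.pred (b j))) + δProduct x tab * h (x ∷ tab ++ []) (ℤ.pred (b j)))
          ≈⟨ *-congˡ (+-cong (reflexive (≡.cong (newtonSum x tab []) (ℤ.suc-pred (b j))))
                             (trans (*-congʳ (δProduct-drop x N xs 0 i z≤n (δ-refl x))) (zeroˡ _))) ⟩
        r i * (newtonSum x tab [] (b j) + 0#)
          ≈⟨ *-congˡ (trans (+-identityʳ _) (newtonSum-tabulate x N xs (b j))) ⟩
        r i * sumFin N (λ k → δProduct x (drop (suc (toℕ k)) tab) * shiftedMatrix b k j)
          ≈⟨ sumFin-*ˡ N (r i) _ ⟩
        sumFin N (λ k → r i * (δProduct x (drop (suc (toℕ k)) tab) * shiftedMatrix b k j))
          ≈⟨ sumFin-cong N (λ k → sym (*-assoc _ _ _)) ⟩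
        matMul N (newtonMatrix r) (shiftedMatrix b) i j ∎
        where
        x = xs i
        tab = List.tabulate xs

      det-factorisation : ∀ r (b : Fin N → ℤ) (e : Fin N → ℕ) → (∀ j → + N ℤ.+ ℤ.pred (b j) ≡ + e j) →
        ∀ A → (∀ i j → A i j ≈ r i * h (xs i ∷ []) (+ e j)) →
        det N A ≈ diagonalProduct N (newtonMatrix r) * det N (shiftedMatrix b)
      det-factorisation r b e b≈e A A≈ = trans
        (det-cong N (λ i j → trans (A≈ i j) (entry≈matMul r b e b≈e i j)))
        (det-upperTriangular-matMul N (newtonMatrix r) (shiftedMatrix b) (newtonMatrix-upperTriangular r))

      det-partition-factorisation : ∀ r (E : Fin N → ℕ → Carrier) → (∀ i e → E i e ≈ r i * h (xs i ∷ []) (+ e)) →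
        ∀ lam → det N (λ i j → E i (ex N lam j)) ≈ diagonalProduct N (newtonMatrix r) * det N (shiftedMatrix (partitionIndex lam))
      det-partition-factorisation r E E≈ lam =
        det-factorisation r (partitionIndex lam) (ex N lam) (partitionExponent≡index N lam) _ (λ i j → E≈ i (ex N lam j))

      module _ (h-negative : ∀ S m → h S -[1+ m ] ≈ 0#) (h-zero : ∀ S → h S (+ 0) ≈ 1#) where

        det-partition-ratio : ∀ r (E : Fin N → ℕ → Carrier) → (∀ i e → E i e ≈ r i * h (xs i ∷ []) (+ e)) →
          ∀ lam → det N (λ i j → E i (ex N lam j))
                  ≈ det N (λ i j → E i (ex N (zero-part lam) j)) * det N (shiftedMatrix (partitionIndex lam))
        det-partition-ratio r E E≈ lam = begin
          det N (λ i j → E i (ex N lam j))            ≈⟨ det-partition-factorisation r E E≈ lam ⟩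
          D * det N (shiftedMatrix (partitionIndex lam))
            ≈⟨ *-congʳ (sym (trans (*-congˡ (det-zeroPartition h h-negative h-zero N _ lam)) (*-identityʳ D))) ⟩
          (D * det N (shiftedMatrix (partitionIndex (zero-part lam)))) * det N (shiftedMatrix (partitionIndex lam))
            ≈⟨ *-congʳ (sym (det-partition-factorisation r E E≈ (zero-part lam))) ⟩
          det N (λ i j → E i (ex N (zero-part lam) j)) * det N (shiftedMatrix (partitionIndex lam)) ∎
          where D = diagonalProduct N (newtonMatrix r)

module FactorialCharacters {c ℓ : Level} (R : CommutativeRing c ℓ) where
  open CommutativeRing R hiding (zero)
  open Factorial R
  open RingProperties ring using (-0#≈0#)
  open Determinants R
  open PowerSeries R
  open GeneratingFunctions R
  open ProductFamilies R
  open DividedDifferences R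
  open IntegerCoefficientSolver R using (solve; _:+_; _:*_; _:=_)
  open SeriesSolver using () renaming (solve to solve⊛; _:+_ to _⊞_; _:*_ to _⊠_; :-_ to ⊟_; _:=_ to _⊜_; con to con⊛)
  open import Relation.Binary.Reasoning.Setoid setoid

  InversePair : Set (c ⊔ ℓ)
  InversePair = Σ (Carrier × Carrier) IsInversePair

  numerator-entry : ∀ a r (A : Series) y ȳ Y Ȳ → (const r ⊛ A) ≋ ((const y ⊛ geom Y) ⊕ negS (const ȳ ⊛ geom Ȳ)) →
    ∀ e → y * fpow Y a e - ȳ * fpow Ȳ a e ≈ r * (A ⊛ aProd a e) e
  numerator-entry a r A y ȳ Y Ȳ rA≋ e = sym (begin
    r * (A ⊛ P) e                                              ≈⟨ const-⊛ r (A ⊛ P) e ⟨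
    (const r ⊛ (A ⊛ P)) e                                      ≈⟨ SR.*-assoc (const r) A P e ⟨
    ((const r ⊛ A) ⊛ P) e                                      ≈⟨ SR.*-congʳ {P} rA≋ e ⟩
    (((const y ⊛ geom Y) ⊕ negS (const ȳ ⊛ geom Ȳ)) ⊛ P) e
      ≈⟨ solve⊛ 5 (λ cy gy cb gb p → (cy ⊠ gy ⊞ ⊟ (cb ⊠ gb)) ⊠ p ⊜ cy ⊠ (gy ⊠ p) ⊞ ⊟ (cb ⊠ (gb ⊠ p)))
                   SR.refl (const y) (geom Y) (const ȳ) (geom Ȳ) P e ⟩
    (const y ⊛ (geom Y ⊛ P)) e - (const ȳ ⊛ (geom Ȳ ⊛ P)) e
      ≈⟨ +-cong (const-⊛ y (geom Y ⊛ P) e) (-‿cong (const-⊛ ȳ (geom Ȳ ⊛ P) e)) ⟩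
    y * (geom Y ⊛ P) e - ȳ * (geom Ȳ ⊛ P) e
      ≈⟨ +-cong (*-congˡ (fpow≈coeff Y a e)) (-‿cong (*-congˡ (fpow≈coeff Ȳ a e))) ⟨
    y * fpow Y a e - ȳ * fpow Ȳ a e                          ∎)
    where P = aProd a e

  module GL (a : ℕ → Carrier) where
    open ProductFamily a oneS geom

    fpow≈family : ∀ y e → fpow y a e ≈ 1# * family (y ∷ []) (+ e)
    fpow≈family y e = trans (fpow≈coeff y a e)
      (trans (⊛-cong {g = aProd a e} (SR.sym (SR.*-identityˡ (geom y))) (λ _ → refl) e)
      (trans (sym (family-single y e)) (sym (*-identityˡ _))))

    hgl≈family : ∀ S z → hgl S a z ≈ family S z
    hgl≈family S (+ m)    = ⊛-cong {g = aProd a (List.length S ℕ.+ m ℕ.∸ 1)} (SR.sym (SR.*-identityˡ (gProduct S))) (λ _ → refl) m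
    hgl≈family S -[1+ _ ] = refl

    gl-jacobiTrudi : ∀ N x lam → glDet N x a lam ≈ glDet N x a (zero-part lam) * glJT N x a lam
    gl-jacobiTrudi N x lam = trans
      (det-partition-ratio family (λ y s → y - s) (λ y s → family-recurrence y s (y - s) (geom-difference y s))
        N x -‿inverseʳ (λ _ _ → refl) (family-zero refl (λ _ → refl))
        (λ _ → 1#) (λ i e → fpow (x i) a e) (λ i → fpow≈family (x i)) lam)
      (*-congˡ (det-cong N (λ k j → sym (hgl≈family (tail-from x k) (idx lam k j)))))

  geom²-coeff₀ : ∀ p → geom² p 0 ≈ 1#
  geom²-coeff₀ (y , ȳ) = trans (⊛-coeff₀ (geom y) (geom ȳ)) (*-identityˡ 1#)

  -- f is proj₁ for sp and o; for so it squares both entries, as there x_i = z_i².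
  module PairFamily (a : ℕ → Carrier) (Q : Series) (f : InversePair → Carrier × Carrier) (f-inverse : ∀ p → IsInversePair (f p)) where
    open ProductFamily a Q geom² public

    pairFamily : List InversePair → ℤ → Carrier
    pairFamily S = family (List.map f S)

    pairDifference : InversePair → InversePair → Carrier
    pairDifference p q = pairSum (f p) - pairSum (f q)

    pairFamily-recurrence : ∀ y s T b →
      pairFamily (y ∷ T) (ℤ.suc b) ≈ pairFamily (s ∷ T) (ℤ.suc b) + pairDifference y s * pairFamily (y ∷ s ∷ T) b
    pairFamily-recurrence y s T = family-recurrence (f y) (f s) (pairDifference y s)
      (geom²-difference (f y) (f s) (f-inverse y) (f-inverse s)) (List.map f T)

    pairDifference-refl : ∀ p → pairDifference p p ≈ 0#
    pairDifference-refl p = -‿inverseʳ _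

    pair-jacobiTrudi : Q 0 ≈ 1# → ∀ N (xs : Fin N → InversePair) r (E : Fin N → ℕ → Carrier) →
      (∀ i e → E i e ≈ r i * family (f (xs i) ∷ []) (+ e)) → ∀ lam →
      det N (λ i j → E i (ex N lam j))
        ≈ det N (λ i j → E i (ex N (zero-part lam) j)) * det N (λ k j → family (tail-from (λ i → f (xs i)) k) (idx lam k j))
    pair-jacobiTrudi Q₀≈1 N xs r E E≈ lam = trans
      (det-partition-ratio pairFamily pairDifference pairFamily-recurrence N xs pairDifference-refl
        (λ _ _ → refl) (λ S → family-zero Q₀≈1 geom²-coeff₀ (List.map f S)) r E E≈ lam)
      (*-congˡ (det-cong N (λ k j → reflexive (≡.cong (λ L → family L (idx lam k j)) (map-drop-tabulate N xs f (toℕ k))))))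

  module SP (a : ℕ → Carrier) where
    open PairFamily a oneS proj₁ proj₂

    spNumerator-entry : ∀ y ȳ e → y * fpow y a e - ȳ * fpow ȳ a e ≈ (y - ȳ) * family ((y , ȳ) ∷ []) (+ e)
    spNumerator-entry y ȳ e = trans (numerator-entry a (y - ȳ) (geom² (y , ȳ)) y ȳ y ȳ (scaled-geom-difference y ȳ) e)
      (*-congˡ (trans (⊛-cong {g = aProd a e} (SR.sym (SR.*-identityˡ (geom² (y , ȳ)))) (λ _ → refl) e) (sym (family-single (y , ȳ) e))))

    hsp≈family : ∀ S z → hsp S a z ≈ family S z
    hsp≈family S (+ m)    = ⊛-cong {g = aProd a (List.length S ℕ.+ m ℕ.∸ 1)} (SR.sym (SR.*-identityˡ (gProduct S))) (λ _ → refl) m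
    hsp≈family S -[1+ _ ] = refl

    sp-jacobiTrudi : ∀ N x x̄ → (∀ i → x i * x̄ i ≈ 1#) → ∀ lam →
      spDet N x x̄ a lam ≈ spDet N x x̄ a (zero-part lam) * spJT N x x̄ a lam
    sp-jacobiTrudi N x x̄ xx̄≈1 lam = trans
      (pair-jacobiTrudi refl N (λ i → (x i , x̄ i) , xx̄≈1 i) (λ i → x i - x̄ i)
        (λ i e → x i * fpow (x i) a e - x̄ i * fpow (x̄ i) a e) (λ i → spNumerator-entry (x i) (x̄ i)) lam)
      (*-congˡ (det-cong N (λ k j → sym (hsp≈family (tail-from (pairUp x x̄) k) (idx lam k j)))))

  square : InversePair → Carrier × Carrier
  square ((z , z̄) , _) = (z * z , z̄ * z̄)

  square-inverse : ∀ p → IsInversePair (square p)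
  square-inverse ((z , z̄) , zz̄≈1) =
    trans (solve 2 (λ z z̄ → (z :* z) :* (z̄ :* z̄) := (z :* z̄) :* (z :* z̄)) refl z z̄) (trans (*-cong zz̄≈1 zz̄≈1) (*-identityˡ 1#))

  module SO (a : ℕ → Carrier) where
    open PairFamily a (lin 1#) square square-inverse

    soNumerator-entry : ∀ z z̄ → z * z̄ ≈ 1# → ∀ e →
      z * fpow (z * z) a e - z̄ * fpow (z̄ * z̄) a e ≈ (z - z̄) * family ((z * z , z̄ * z̄) ∷ []) (+ e)
    soNumerator-entry z z̄ zz̄≈1 e = trans
      (numerator-entry a (z - z̄) (lin 1# ⊛ geom² (z * z , z̄ * z̄)) z z̄ (z * z) (z̄ * z̄) (scaled-geom-difference-squares z z̄ zz̄≈1) e)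
      (*-congˡ (sym (family-single (z * z , z̄ * z̄) e)))

    so-jacobiTrudi : ∀ N z z̄ → (∀ i → z i * z̄ i ≈ 1#) → ∀ lam →
      soDet N z z̄ a lam ≈ soDet N z z̄ a (zero-part lam) * ooJT N (λ i → z i * z i) (λ i → z̄ i * z̄ i) a lam
    so-jacobiTrudi N z z̄ zz̄≈1 lam = trans
      (pair-jacobiTrudi refl N (λ i → (z i , z̄ i) , zz̄≈1 i) (λ i → z i - z̄ i)
        (λ i e → z i * fpow (z i * z i) a e - z̄ i * fpow (z̄ i * z̄ i) a e) (λ i → soNumerator-entry (z i) (z̄ i) (zz̄≈1 i)) lam)
      (*-congˡ (det-cong N (λ k j → family≈hoo _ (idx lam k j))))
      where
      family≈hoo : ∀ S w → family S w ≈ hoo S a w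
      family≈hoo S (+ _)    = refl
      family≈hoo S -[1+ _ ] = refl

  module O (a : ℕ → Carrier) where
    open PairFamily a oneMinusT² proj₁ proj₂

    oSingle : Carrier × Carrier → ℕ → Carrier
    oSingle (y , ȳ) m = ((geom y ⊕ geom ȳ) ⊛ aProd a m) m

    -- h^{eo} of one variable has constant term 2 - 1; keeping the 2 makes the recurrence hold for all lists
    oFamily : List InversePair → ℤ → Carrier
    oFamily (p ∷ []) (+ m)    = oSingle (proj₁ p) m
    oFamily (p ∷ []) -[1+ _ ] = 0#
    oFamily S        w        = pairFamily S w

    oFamily-negative : ∀ S m → oFamily S -[1+ m ] ≈ 0#
    oFamily-negative []          m = refl
    oFamily-negative (p ∷ [])    m = refl
    oFamily-negative (p ∷ q ∷ S) m = refl

    geomSum : InversePair → Series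
    geomSum ((y , ȳ) , _) = geom y ⊕ geom ȳ

    geomSum-difference : ∀ p q → (geomSum p ⊕ negS (geomSum q))
      ≋ ((const (pairDifference p q) ⊛ t) ⊛ generating (proj₁ p ∷ proj₁ q ∷ []))
    geomSum-difference (p , p⁻¹) (q , q⁻¹) =
      SR.trans (SR.+-cong (geom-sum (proj₁ p) (proj₂ p) p⁻¹) (SR.-‿cong (geom-sum (proj₁ q) (proj₂ q) q⁻¹)))
      (SR.trans (solve⊛ 4 (λ u gp gq o → (u ⊠ gp ⊞ o) ⊞ ⊟ (u ⊠ gq ⊞ o) ⊜ u ⊠ (gp ⊞ ⊟ gq))
                         SR.refl oneMinusT² (geom² p) (geom² q) oneS)
      (SR.trans (SR.*-congˡ {oneMinusT²} (geom²-difference p q p⁻¹ q⁻¹))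
                (solve⊛ 5 (λ u d t′ gp gq → u ⊠ ((d ⊠ t′) ⊠ (gp ⊠ gq)) ⊜ (d ⊠ t′) ⊠ (u ⊠ (gp ⊠ (gq ⊠ con⊛ (+ 1)))))
                   SR.refl oneMinusT² (const (pairSum p - pairSum q)) t (geom² p) (geom² q))))

    oFamily-recurrence : ∀ y s T b →
      oFamily (y ∷ T) (ℤ.suc b) ≈ oFamily (s ∷ T) (ℤ.suc b) + pairDifference y s * oFamily (y ∷ s ∷ T) b
    oFamily-recurrence y s (u ∷ T) b        = pairFamily-recurrence y s (u ∷ T) b
    oFamily-recurrence y s [] (+ m)         =
      ⊛-recurrence-suc (pairDifference y s) (geomSum y) (geomSum s) (generating (proj₁ y ∷ proj₁ s ∷ []))
        (geomSum-difference y s) (aProd a (suc m)) m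
    oFamily-recurrence y s [] -[1+ zero ]   = trans
      (⊛-recurrence-zero (pairDifference y s) (geomSum y) (geomSum s) (generating (proj₁ y ∷ proj₁ s ∷ [])) (geomSum-difference y s) (aProd a 0))
      (trans (sym (+-identityʳ _)) (+-congˡ (sym (zeroʳ _))))
    oFamily-recurrence y s [] -[1+ suc _ ]  = trans (sym (+-identityʳ 0#)) (+-congˡ (sym (zeroʳ _)))

    oNumerator-entry : ∀ y ȳ e → fpow y a e + fpow ȳ a e ≈ 1# * oSingle (y , ȳ) e
    oNumerator-entry y ȳ e = sym (trans (*-identityˡ _) (trans (⊛-distribʳ (geom y) (geom ȳ) (aProd a e) e)
      (sym (+-cong (fpow≈coeff y a e) (fpow≈coeff ȳ a e)))))

    oSingle-zero : ∀ p → oSingle p 0 ≈ 1# + 1#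
    oSingle-zero (y , ȳ) = trans (⊛-coeff₀ (geom y ⊕ geom ȳ) (aProd a 0)) (trans (*-congˡ (aProd-coeff₀ a 0)) (*-identityʳ _))

    heo-zero : ∀ S → heo S a (+ 0) ≈ 1#
    heo-zero []          = trans (⊛-coeff₀ oneS (aProd a 0)) (trans (*-identityˡ _) (aProd-coeff₀ a 0))
    heo-zero (p ∷ [])    = trans (⊛-coeff₀ ((geom (proj₁ p) ⊕ geom (proj₂ p)) ⊖ δ0 0) (aProd a 0))
      (trans (*-congˡ (aProd-coeff₀ a 0)) (trans (*-identityʳ _)
      (trans (+-assoc 1# 1# (- 1#)) (trans (+-congˡ (-‿inverseʳ 1#)) (+-identityʳ 1#)))))
    heo-zero (p ∷ q ∷ S) = family-zero refl geom²-coeff₀ (p ∷ q ∷ S)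

    oFamily≈heo : ∀ p S w → (S ≡ [] → w ≢ + 0) → oFamily (p ∷ S) w ≈ heo (proj₁ p ∷ List.map proj₁ S) a w
    oFamily≈heo p (q ∷ S) (+ m)      _  = refl
    oFamily≈heo p (q ∷ S) -[1+ m ]   _  = refl
    oFamily≈heo p []      (+ zero)   w≢0 = ⊥-elim (w≢0 ≡.refl ≡.refl)
    oFamily≈heo p []      (+ suc m)  _  =
      ⊛-cong {g = aProd a (suc m)} (λ _ → sym (trans (+-congˡ -0#≈0#) (+-identityʳ _))) (λ _ → refl) (suc m)
    oFamily≈heo p []      -[1+ m ]   _  = refl

    twoEta-cong : ∀ k {u v} → u ≈ v → twoEta k u ≈ twoEta k v
    twoEta-cong zero    u≈v = u≈v
    twoEta-cong (suc _) u≈v = +-cong u≈v u≈v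

    twoEta-*ˡ : ∀ k d v → twoEta k (d * v) ≈ d * twoEta k v
    twoEta-*ˡ zero    d v = refl
    twoEta-*ˡ (suc _) d v = sym (distribˡ d v v)

    lastRowIndex≢0 : ∀ n (lam : Fin (suc n) → ℕ) j → lam (fromℕ n) ≢ 0 → partitionIndex lam j ℤ.+ + n ≢ + 0
    lastRowIndex≢0 n lam j λₙ≢0 index≡0 = λₙ≢0 (≡.subst (λ k → lam k ≡ 0) jₙ≡fromℕ λⱼ≡0)
      where
      exponent≡0 : ex (suc n) lam j ≡ 0
      exponent≡0 = ℤ.+-injective (≡.trans (≡.sym (partitionExponent≡index (suc n) lam j))
        (≡.trans (last-identity (+ n) (partitionIndex lam j)) index≡0))
      λⱼ≡0 : lam j ≡ 0
      λⱼ≡0 = ℕ.m+n≡0⇒m≡0 (lam j) exponent≡0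
      jₙ≡fromℕ : j ≡ fromℕ n
      jₙ≡fromℕ = Fin.toℕ-injective (≡.trans
        (ℕ.≤-antisym (Fin.toℕ≤pred[n] j) (ℕ.m∸n≡0⇒m≤n (ℕ.m+n≡0⇒n≡0 (lam j) exponent≡0)))
        (≡.sym (Fin.toℕ-fromℕ n)))

    module _ (n : ℕ) (x x̄ : Fin (suc n) → Carrier) (xx̄≈1 : ∀ i → x i * x̄ i ≈ 1#) where

      xs : Fin (suc n) → InversePair
      xs i = (x i , x̄ i) , xx̄≈1 i

      row : Fin (suc n) → List InversePair
      row k = drop (toℕ k) (List.tabulate xs)

      oMatrix eoMatrix : (Fin (suc n) → ℕ) → Fin (suc n) → Fin (suc n) → Carrier
      oMatrix  lam k j = oFamily (row k) (idx lam k j)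
      eoMatrix lam k j = heo (tail-from (pairUp x x̄) k) a (idx lam k j)

      restrict : (Fin (suc n) → Fin (suc n) → Carrier) → Fin n → Fin n → Carrier
      restrict M i j = M (Fin.inject₁ i) (Fin.inject₁ j)

      triangularFactor : Carrier
      triangularFactor = diagonalProduct (suc n) (newtonMatrix oFamily pairDifference oFamily-recurrence (suc n) xs pairDifference-refl (λ _ → 1#))

      oDet-factorisation : ∀ lam → oDet (suc n) x x̄ a lam ≈ triangularFactor * det (suc n) (oMatrix lam)
      oDet-factorisation = det-partition-factorisation oFamily pairDifference oFamily-recurrence (suc n) xs pairDifference-refl
        (λ _ → 1#) (λ i e → fpow (x i) a e + fpow (x̄ i) a e) (λ i → oNumerator-entry (x i) (x̄ i))

      oMatrix≈eoMatrix : ∀ lam k j → (toℕ k ≡ n → idx lam k j ≢ + 0) → oMatrix lam k j ≈ eoMatrix lam k j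
      oMatrix≈eoMatrix lam k j lastRow⇒≢0 = begin
        oFamily (drop (toℕ k) (List.tabulate xs)) w
          ≈⟨ reflexive (≡.cong (λ L → oFamily L w) (drop-tabulate (suc n) xs k)) ⟩
        oFamily (xs k ∷ drop (suc (toℕ k)) (List.tabulate xs)) w
          ≈⟨ oFamily≈heo (xs k) _ w (λ empty → lastRow⇒≢0 (drop-tabulate-empty n xs k empty)) ⟩
        heo (List.map proj₁ (xs k ∷ drop (suc (toℕ k)) (List.tabulate xs))) a w
          ≈⟨ reflexive (≡.cong (λ L → heo L a w) (≡.trans (≡.cong (List.map proj₁) (≡.sym (drop-tabulate (suc n) xs k)))
                                                       (map-drop-tabulate (suc n) xs proj₁ (toℕ k)))) ⟩
        heo (tail-from (pairUp x x̄) k) a w ∎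
        where w = idx lam k j

      module _ (lam : Fin (suc n) → ℕ) (λₙ≡0 : lam (fromℕ n) ≡ 0) where

        lastColumnIndex : ∀ k → idx lam k (fromℕ n) ≡ (ℤ.0ℤ ℤ.- + n) ℤ.+ + toℕ k
        lastColumnIndex k = ≡.cong₂ (λ l m → (+ l ℤ.- + m) ℤ.+ + toℕ k) λₙ≡0 (Fin.toℕ-fromℕ n)

        aboveCornerIndex : ∀ i → ∃ λ m → idx lam (Fin.inject₁ i) (fromℕ n) ≡ -[1+ m ]
        aboveCornerIndex i = proj₁ below , ≡.trans (lastColumnIndex (Fin.inject₁ i))
          (≡.trans (≡.cong (λ m → (ℤ.0ℤ ℤ.- + n) ℤ.+ + m) (Fin.toℕ-inject₁ i)) (proj₂ below))
          where below = negativeIndex n (toℕ i) (Fin.toℕ<n i)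

        cornerIndex : idx lam (fromℕ n) (fromℕ n) ≡ + 0
        cornerIndex = ≡.trans (lastColumnIndex (fromℕ n))
          (≡.trans (≡.cong (λ m → (ℤ.0ℤ ℤ.- + n) ℤ.+ + m) (Fin.toℕ-fromℕ n)) (diagonalIndex n))

        restrict-oMatrix≈eoMatrix : ∀ i j → restrict (oMatrix lam) i j ≈ restrict (eoMatrix lam) i j
        restrict-oMatrix≈eoMatrix i j = oMatrix≈eoMatrix lam (Fin.inject₁ i) (Fin.inject₁ j)
          (λ k≡n _ → ℕ.<-irrefl (≡.trans (≡.sym (Fin.toℕ-inject₁ i)) k≡n) (Fin.toℕ<n i))

        det-oMatrix-lastColumn : det (suc n) (oMatrix lam) ≈ (1# + 1#) * det n (restrict (eoMatrix lam))
        det-oMatrix-lastColumn = trans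
          (det-lastColumn n (oMatrix lam) (λ i → trans (reflexive (≡.cong (oFamily (row (Fin.inject₁ i))) (proj₂ (aboveCornerIndex i))))
                                                       (oFamily-negative (row (Fin.inject₁ i)) _)))
          (*-cong (trans (reflexive (≡.cong₂ oFamily (drop-tabulate-last n xs) cornerIndex)) (oSingle-zero (x (fromℕ n) , x̄ (fromℕ n))))
                  (det-cong n restrict-oMatrix≈eoMatrix))

        det-eoMatrix-lastColumn : det (suc n) (eoMatrix lam) ≈ det n (restrict (eoMatrix lam))
        det-eoMatrix-lastColumn = trans
          (det-lastColumn n (eoMatrix lam) (λ i → reflexive (≡.cong (heo _ a) (proj₂ (aboveCornerIndex i)))))
          (trans (*-congʳ (trans (reflexive (≡.cong₂ (λ L w → heo L a w) (drop-tabulate-last n (pairUp x x̄)) cornerIndex))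
                                 (heo-zero ((x (fromℕ n) , x̄ (fromℕ n)) ∷ []))))
                 (*-identityˡ _))

      twoEta-oMatrix : ∀ lam → twoEta (lam (fromℕ n)) (det (suc n) (oMatrix lam)) ≈ (1# + 1#) * det (suc n) (eoMatrix lam)
      twoEta-oMatrix lam with lam (fromℕ n) in λₙ≡
      ... | zero  = trans (det-oMatrix-lastColumn lam λₙ≡) (*-congˡ (sym (det-eoMatrix-lastColumn lam λₙ≡)))
      ... | suc _ = trans (+-cong O≈E O≈E) (sym (trans (distribʳ _ 1# 1#) (+-cong (*-identityˡ _) (*-identityˡ _))))
        where
        O≈E : det (suc n) (oMatrix lam) ≈ det (suc n) (eoMatrix lam)
        O≈E = det-cong (suc n) (λ k j → oMatrix≈eoMatrix lam k j (λ k≡n → ≡.subst (λ m → partitionIndex lam j ℤ.+ + m ≢ + 0) (≡.sym k≡n)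
          (lastRowIndex≢0 n lam j (λ λₙ≡0 → ℕ.0≢1+n (≡.trans (≡.sym λₙ≡0) λₙ≡)))))

      oDet-zeroPartition : ∀ lam → oDet (suc n) x x̄ a (zero-part lam) ≈ triangularFactor * (1# + 1#)
      oDet-zeroPartition lam = trans (oDet-factorisation (zero-part lam)) (*-congˡ (trans (twoEta-oMatrix (zero-part lam))
        (trans (*-congˡ (det-zeroPartition (λ S w → heo S a w) (λ _ _ → refl) heo-zero (suc n) (tail-from (pairUp x x̄)) lam))
               (*-identityʳ _))))

      o-jacobiTrudi : ∀ lam → twoEta (lam (fromℕ n)) (oDet (suc n) x x̄ a lam) ≈ oDet (suc n) x x̄ a (zero-part lam) * eoJT (suc n) x x̄ a lam
      o-jacobiTrudi lam = begin
        twoEta λₙ (oDet (suc n) x x̄ a lam)                      ≈⟨ twoEta-cong λₙ (oDet-factorisation lam) ⟩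
        twoEta λₙ (triangularFactor * det (suc n) (oMatrix lam)) ≈⟨ twoEta-*ˡ λₙ triangularFactor _ ⟩
        triangularFactor * twoEta λₙ (det (suc n) (oMatrix lam)) ≈⟨ *-congˡ (twoEta-oMatrix lam) ⟩
        triangularFactor * ((1# + 1#) * eoJT (suc n) x x̄ a lam)  ≈⟨ *-assoc _ _ _ ⟨
        (triangularFactor * (1# + 1#)) * eoJT (suc n) x x̄ a lam  ≈⟨ *-congʳ (oDet-zeroPartition lam) ⟨
        oDet (suc n) x x̄ a (zero-part lam) * eoJT (suc n) x x̄ a lam ∎
        where λₙ = lam (fromℕ n)

theorem1 : ∀ {c ℓ : Level} (R : CommutativeRing c ℓ) →
    let open CommutativeRing R
        open Factorial R
    in (n : ℕ) (lam : Fin (suc n) → ℕ) → IsPartition (suc n) lam →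
       (a : ℕ → Carrier) →
       (x xb : Fin (suc n) → Carrier) → (∀ i → x i * xb i ≈ 1#) →
       (z zb : Fin (suc n) → Carrier) → (∀ i → z i * zb i ≈ 1#) →
         (glDet (suc n) x a lam
            ≈ glDet (suc n) x a (zero-part lam) * glJT (suc n) x a lam)
       × (spDet (suc n) x xb a lam
            ≈ spDet (suc n) x xb a (zero-part lam) * spJT (suc n) x xb a lam)
       × (soDet (suc n) z zb a lam
            ≈ soDet (suc n) z zb a (zero-part lam)
              * ooJT (suc n) (λ i → z i * z i) (λ i → zb i * zb i) a lam)
       × (twoEta (lam (fromℕ n)) (oDet (suc n) x xb a lam)
            ≈ oDet (suc n) x xb a (zero-part lam) * eoJT (suc n) x xb a lam)
-- The identities hold for every λ.
theorem1 R n lam _ a x xb xxb≈1 z zb zzb≈1 =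
    GL.gl-jacobiTrudi a (suc n) x lam
  , SP.sp-jacobiTrudi a (suc n) x xb xxb≈1 lam
  , SO.so-jacobiTrudi a (suc n) z zb zzb≈1 lam
  , O.o-jacobiTrudi a n x xb xxb≈1 lam
  where open FactorialCharacters R
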